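{- Let $N\ge1$, $f:\mathbb{N}^N\to\mathbb{N}$, $k\ge 0$ and $\boldsymbol{\ell}\in\mathbb{N}^N$. Then: (1) $\displaystyle\binom{k}{\boldsymbol{\ell}}_f=\sum_{(r_1,r_2,\ldots)\in\mathcal{P}(\boldsymbol{\ell};k)}\frac{k!}{r_1!\,r_2!\cdots}\prod_{i} f(\mathbf{s}_i)^{r_i}$. (2) (Vandermonde convolution) For every $r\ge 1$ and every tuple $(k_1,\dots,k_r)$ of nonnegative integers with $k_1+\cdots+k_r=k$, $\displaystyle\binom{k}{\boldsymbol{\ell}}_f=\sum_{\mathbf{q}_1+\cdots+\mathbf{q}_r=\boldsymbol{\ell}}\binom{k_1}{\mathbf{q}_1}_f\cdots\binom{k_r}{\mathbf{q}_r}_f$, the sum over all $(\mathbf{q}_1,\dots,\mathbf{q}_r)\in(\mathbb{N}^N)^r$ with $\mathbf{q}_1+\cdots+\mathbf{q}_r=\boldsymbol{\ell}$. (3) For every integer $i$ with $0<i\le k$, the vector identity $\displaystyle\boldsymbol{\ell}\binom{k}{\boldsymbol{\ell}}_f=\frac{k}{i}\sum_{\mathbf{s}\in\mathbb{N}^N}\mathbf{s}\binom{i}{\mathbf{s}}_f\binom{k-i}{\boldsymbol{\ell}-\mathbf{s}}_f$ holds. (4) For every $\mathbf{m}\in\mathbb{N}^N$, $\displaystyle\binom{k}{\boldsymbol{\ell}}_f=\sum_{i\in\mathbb{N}}f(\mathbf{m})^i\binom{k}{i}\binom{k-i}{\boldsymbol{\ell}-\mathbf{m}i}_{g}$, where $g:\mathbb{N}^N\to\mathbb{N}$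 is given by $g(\mathbf{s})=f(\mathbf{s})$ for $\mathbf{s}\neq\mathbf{m}$ and $g(\mathbf{m})=0$ (only terms with $i\le k$ are present, since $\binom{k}{i}=0$ for $i>k$).
   Context: $\mathbb{N}=\{0,1,2,\dots\}$. For $k\ge0$ and $\boldsymbol{\ell}\in\mathbb{N}^N$, $\binom{k}{\boldsymbol{\ell}}_f=\sum f(\mathbf{m}_1)\cdots f(\mathbf{m}_k)$ over all ordered $k$-tuples of vectors $\mathbf{m}_j\in\mathbb{N}^N$ with $\mathbf{m}_1+\cdots+\mathbf{m}_k=\boldsymbol{\ell}$ (for $k=0$: $1$ if $\boldsymbol{\ell}=\mathbf{0}$, else $0$); by convention $\binom{k}{\mathbf{x}}_f=0$ if $\mathbf{x}\in\mathbb{Z}^N$ has a negative entry. $\binom{k}{i}$ is the ordinary binomial coefficient. Let $S_{\mathbf{0}}(\boldsymbol{\ell})=\{\mathbf{s}\in\mathbb{N}^N: 0\le s_j\le \ell_j \text{ for all } j\}$, enumerated as $\mathbf{s}_1,\mathbf{s}_2,\dots$, and $\mathcal{P}(\boldsymbol{\ell};k)$ the set of tuples of nonnegative integers $(r_1,r_2,\dots)$ (multiplicities of $\mathbf{s}_1,\mathbf{s}_2,\dots$) with $\sum_i r_i=k$ and $\sum_i r_i\mathbf{s}_i=\boldsymbol{\ell}$ (vector partitions of $\boldsymbol{\ell}$ into $k$ parts, part $\mathbf{0}$ allowed). Convention $0^0=1$. -}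

module Defs where

import Data.Bool
open import Data.Bool using (Bool; true; false; if_then_else_)
open import Data.Nat as ℕ using (ℕ; zero; suc; _+_; _*_; _^_; _!; NonZero)
open import Data.Nat.Properties using (_!≢0; m*n≢0)
open import Data.Integer as ℤ using (ℤ; +_; -[1+_])
open import Data.Rational as ℚ using (ℚ; 0ℚ; 1ℚ)
open import Data.List as List using (List; []; _∷_; [_]; concatMap; upTo; filter)
open import Data.Vec as Vec using (Vec; []; _∷_; zipWith; replicate)
open import Data.Fin using (Fin)
open import Relation.Nullary using (Dec; yes; no)
open import Relation.Binary.PropositionalEquality using (_≡_)
import Data.Vec.Properties as VecP

_≟v_ : ∀ {N} (x y : Vec ℕ N) → Dec (x ≡ y)
_≟v_ = VecP.≡-dec ℕ._≟_

𝟎 : ∀ {N} → Vec ℕ N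
𝟎 = replicate _ 0

_⊕_ : ∀ {N} → Vec ℕ N → Vec ℕ N → Vec ℕ N
_⊕_ = zipWith _+_

_·v_ : ∀ {N} → ℕ → Vec ℕ N → Vec ℕ N
c ·v v = Vec.map (c *_) v

vsum : ∀ {N k} → Vec (Vec ℕ N) k → Vec ℕ N
vsum []       = 𝟎
vsum (m ∷ ms) = m ⊕ vsum ms

sumℕ : List ℕ → ℕ
sumℕ = List.foldr _+_ 0

sumℚ : List ℚ → ℚ
sumℚ = List.foldr ℚ._+_ 0ℚ

box : ∀ {N} → Vec ℕ N → List (Vec ℕ N)
box []       = [ [] ]
box (x ∷ xs) = concatMap (λ a → List.map (a ∷_) (box xs)) (upTo (suc x))

tuples : ∀ {A : Set} (k : ℕ) → List A → List (Vec A k)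
tuples zero    xs = [ [] ]
tuples (suc k) xs = concatMap (λ x → List.map (x ∷_) (tuples k xs)) xs

-- All ordered k-tuples (m₁,…,m_k) of vectors in ℕ^N with m₁+⋯+m_k = ℓ.
-- (Every such tuple has all entries in S₀(ℓ), so enumerating S₀(ℓ)^k
--  and filtering gives exactly these tuples.)
tuplesSumming : ∀ {N} (k : ℕ) → Vec ℕ N → List (Vec (Vec ℕ N) k)
tuplesSumming k ℓ = filter (λ ms → vsum ms ≟v ℓ) (tuples k (box ℓ))

prodF : ∀ {N k} → (Vec ℕ N → ℕ) → Vec (Vec ℕ N) k → ℕ
prodF f []       = 1
prodF f (m ∷ ms) = f m * prodF f ms

binom : ∀ {N} → (Vec ℕ N → ℕ) → ℕ → Vec ℕ N → ℕ
binom f k ℓ = sumℕ (List.map (prodF f) (tuplesSumming k ℓ))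

nonneg : ∀ {N} → Vec ℤ N → Bool
nonneg []            = true
nonneg (+ _ ∷ xs)    = nonneg xs
nonneg (-[1+ _ ] ∷ xs) = false

binomℤ : ∀ {N} → (Vec ℕ N → ℕ) → ℕ → Vec ℤ N → ℕ
binomℤ f k x = if nonneg x then binom f k (Vec.map ℤ.∣_∣ x) else 0

toℤv : ∀ {N} → Vec ℕ N → Vec ℤ N
toℤv = Vec.map (λ n → + n)

_⊖_ : ∀ {N} → Vec ℕ N → Vec ℕ N → Vec ℤ N
x ⊖ y = zipWith ℤ._-_ (toℤv x) (toℤv y)

ℕ→ℚ : ℕ → ℚ
ℕ→ℚ n = + n ℚ./ 1

-- Vector partitions  P(ℓ; k)
-- S₀(ℓ) enumerated as s₁, s₂, … , s_M  (M = |S₀(ℓ)|)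

M : ∀ {N} → Vec ℕ N → ℕ
M ℓ = List.length (box ℓ)

sVec : ∀ {N} (ℓ : Vec ℕ N) → Vec (Vec ℕ N) (M ℓ)
sVec ℓ = Vec.fromList (box ℓ)

lincomb : ∀ {N n} → Vec ℕ n → Vec (Vec ℕ N) n → Vec ℕ N
lincomb []       []       = 𝟎
lincomb (r ∷ rs) (s ∷ ss) = (r ·v s) ⊕ lincomb rs ss

sumV : ∀ {n} → Vec ℕ n → ℕ
sumV = Vec.foldr′ _+_ 0

isPartition : ∀ {N} (ℓ : Vec ℕ N) (k : ℕ) (rs : Vec ℕ (M ℓ)) → Bool
isPartition ℓ k rs with sumV rs ℕ.≟ k | lincomb rs (sVec ℓ) ≟v ℓ
... | yes _ | yes _ = true
... | _     | _     = false

-- P(ℓ; k) as a list (each r_i ≤ k necessarily, since Σ r_i = k)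
partitions : ∀ {N} (ℓ : Vec ℕ N) (k : ℕ) → List (Vec ℕ (M ℓ))
partitions ℓ k = filter (λ rs → isPartition ℓ k rs Data.Bool.≟ true) (tuples (M ℓ) (upTo (suc k)))

prodFact : ∀ {n} → Vec ℕ n → ℕ
prodFact []       = 1
prodFact (r ∷ rs) = (r !) * prodFact rs

prodFact≢0 : ∀ {n} (rs : Vec ℕ n) → NonZero (prodFact rs)
prodFact≢0 []       = _
prodFact≢0 (r ∷ rs) = m*n≢0 (r !) (prodFact rs) {{r !≢0}} {{prodFact≢0 rs}}

multinomial : ∀ {n} → ℕ → Vec ℕ n → ℚ
multinomial k rs = (+ (k !) ℚ./ prodFact rs) {{prodFact≢0 rs}}

-- ∏_i f(s_i)^{r_i}   (with 0^0 = 1)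
prodPow : ∀ {N n} → (Vec ℕ N → ℕ) → Vec ℕ n → Vec (Vec ℕ N) n → ℕ
prodPow f []       []       = 1
prodPow f (r ∷ rs) (s ∷ ss) = (f s ^ r) * prodPow f rs ss

removeAt : ∀ {N} → (Vec ℕ N → ℕ) → Vec ℕ N → (Vec ℕ N → ℕ)
removeAt f m s with s ≟v m
... | yes _ = 0
... | no  _ = f s

prodBinom : ∀ {N r} → (Vec ℕ N → ℕ) → Vec ℕ r → Vec (Vec ℕ N) r → ℕ
prodBinom f []       []       = 1
prodBinom f (k ∷ ks) (q ∷ qs) = binom f k q * prodBinom f ks qs

-- Read f as the power series F = Σₛ f(s) xˢ over ℕ^N; then binom f k ℓ is the coefficient of x^ℓ
-- in Fᵏ.  Coefficient functions with the Cauchy product form a commutative semiring, so (2) is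
-- F^k₁ ⋯ F^kᵣ = Fᵏ, and (4) is the binomial theorem for F = f(m) xᵐ + G.  For (3), the Euler
-- operator θⱼ = xⱼ ∂/∂xⱼ satisfies the Leibniz rule, hence θⱼ(Fᵏ) = k (θⱼF) Fᵏ⁻¹; writing
-- Fᵏ = Fⁱ Fᵏ⁻ⁱ and applying θⱼ to the first factor gives i (θⱼF) Fᵏ⁻¹ as well.  For (1), below ℓ
-- the series F agrees with the polynomial Σ_{s ≤ ℓ} f(s) xˢ, whose k-th power is expanded by
-- iterating the binomial theorem.

module Submission where

open import Defs
open import Data.Nat using (ℕ; suc; _*_; _^_; _∸_; _≤_; _<_; >-nonZero)
open import Data.Nat.Combinatorics using (_C_)
open import Data.Integer using (+_)
open import Data.Rational using (ℚ; _/_) renaming (_*_ to _*ℚ_)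
open import Data.List using (map; upTo)
open import Data.Vec using (Vec; lookup)
open import Data.Fin using (Fin)
open import Data.Product using (_×_)
open import Relation.Binary.PropositionalEquality using (_≡_)

open import Algebra.Bundles using (CommutativeSemiring)
open import Algebra.Structures using (IsCommutativeMonoid)
import Algebra.Structures.Biased as Biased
import Algebra.Construct.Pointwise as PointwiseAlgebra
import Algebra.Definitions.RawSemiring as RawSemiringOps
import Algebra.Properties.Semiring.Exp as Exp
import Algebra.Properties.CommutativeSemiring.Binomial as Binomial
import Algebra.Properties.CommutativeSemigroup as CommutativeSemigroup
open import Data.Bool using (true; false)
import Data.Bool
open import Data.Empty using (⊥-elim)
open import Data.Fin using (zero; suc; toℕ)
open import Data.Integer using (∣_∣)
import Data.Integer as ℤ
import Data.Integer.Properties as ℤ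
open import Data.Integer.Tactic.RingSolver using () renaming (solve-∀ to ℤ-solve-∀)
open import Data.List using (List; []; _∷_; _++_; concatMap; applyUpTo; filter)
open import Data.List.Properties using (map-cong; map-++; map-∘)
open import Data.Nat using (zero; _+_; _!; z≤n; s≤s; s≤s⁻¹; NonZero; _≟_; _≤?_)
open import Data.Nat.Combinatorics using (nCk≡n!/k![n-k]!; k![n∸k]!∣n!)
open import Data.Nat.DivMod using (m/n*n≡m)
open import Data.Nat.ListAction.Properties using (sum-++)
open import Data.Nat.Properties
open import Data.Nat.Tactic.RingSolver using (solve-∀)
open import Data.Product using (_,_)
open import Data.Rational using (fromℚᵘ) renaming (_+_ to _+ℚ_)
import Data.Rational.Properties as ℚ
open import Data.Rational.Unnormalised using (mkℚᵘ; *≡*)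
import Data.Rational.Unnormalised as ℚᵘ
import Data.Rational.Unnormalised.Properties as ℚᵘ
open import Data.Sum using (_⊎_; inj₁; inj₂)
open import Data.Vec using ([]; _∷_; zipWith; replicate)
import Data.Vec as Vec
import Data.Vec.Properties as Vec
open import Data.Vec.Relation.Binary.Pointwise.Inductive as Pointwise using (Pointwise; []; _∷_)
open import Level using (0ℓ)
open import Relation.Binary.PropositionalEquality using (refl; sym; trans; cong; cong₂; subst; module ≡-Reasoning)
import Relation.Binary.PropositionalEquality as ≡
open import Relation.Binary.Structures using (IsEquivalence)
open import Relation.Nullary using (Dec; yes; no; ¬_)
open ≡-Reasoning

module +-CS = CommutativeSemigroup +-commutativeSemigroup
module *-CS = CommutativeSemigroup *-commutativeSemigroup

∑ : ℕ → (ℕ → ℕ) → ℕ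
∑ zero    F = 0
∑ (suc n) F = F 0 + ∑ n (λ a → F (suc a))

∑-cong< : ∀ n {F G : ℕ → ℕ} → (∀ a → a < n → F a ≡ G a) → ∑ n F ≡ ∑ n G
∑-cong< zero    F≡G = refl
∑-cong< (suc n) F≡G = cong₂ _+_ (F≡G 0 (s≤s z≤n)) (∑-cong< n (λ a a<n → F≡G (suc a) (s≤s a<n)))

∑-cong : ∀ n {F G : ℕ → ℕ} → (∀ a → F a ≡ G a) → ∑ n F ≡ ∑ n G
∑-cong n F≡G = ∑-cong< n (λ a _ → F≡G a)

∑-0 : ∀ n {F : ℕ → ℕ} → (∀ a → F a ≡ 0) → ∑ n F ≡ 0
∑-0 zero    F≡0 = refl
∑-0 (suc n) F≡0 = cong₂ _+_ (F≡0 0) (∑-0 n (λ a → F≡0 (suc a)))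

∑-+ : ∀ n (F G : ℕ → ℕ) → ∑ n (λ a → F a + G a) ≡ ∑ n F + ∑ n G
∑-+ zero    F G = refl
∑-+ (suc n) F G = trans (cong (_+_ (F 0 + G 0)) (∑-+ n _ _)) (+-CS.interchange (F 0) (G 0) _ _)

∑-*ˡ : ∀ n c (F : ℕ → ℕ) → ∑ n (λ a → c * F a) ≡ c * ∑ n F
∑-*ˡ zero    c F = sym (*-zeroʳ c)
∑-*ˡ (suc n) c F = trans (cong (_+_ (c * F 0)) (∑-*ˡ n c _)) (sym (*-distribˡ-+ c (F 0) _))

∑-comm : ∀ n m (F : ℕ → ℕ → ℕ) → ∑ n (λ a → ∑ m (F a)) ≡ ∑ m (λ b → ∑ n (λ a → F a b))
∑-comm zero    m F = sym (∑-0 m (λ _ → refl))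
∑-comm (suc n) m F = begin
  ∑ m (F 0) + ∑ n (λ a → ∑ m (F (suc a)))        ≡⟨ cong (_+_ (∑ m (F 0))) (∑-comm n m (λ a → F (suc a))) ⟩
  ∑ m (F 0) + ∑ m (λ b → ∑ n (λ a → F (suc a) b)) ≡⟨ ∑-+ m (F 0) _ ⟨
  ∑ m (λ b → F 0 b + ∑ n (λ a → F (suc a) b))     ∎

∑-last : ∀ n (F : ℕ → ℕ) → ∑ (suc n) F ≡ ∑ n F + F n
∑-last zero    F = +-comm (F 0) 0
∑-last (suc n) F = trans (cong (_+_ (F 0)) (∑-last n _)) (sym (+-assoc (F 0) _ _))

∑-reverse : ∀ x (F : ℕ → ℕ) → ∑ (suc x) F ≡ ∑ (suc x) (λ a → F (x ∸ a))
∑-reverse zero    F = refl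
∑-reverse (suc x) F = begin
  F 0 + ∑ (suc x) (λ a → F (suc a))
    ≡⟨ cong (_+_ (F 0)) (∑-reverse x (λ a → F (suc a))) ⟩
  F 0 + ∑ (suc x) (λ a → F (suc (x ∸ a)))
    ≡⟨ +-comm (F 0) _ ⟩
  ∑ (suc x) (λ a → F (suc (x ∸ a))) + F 0
    ≡⟨ cong₂ _+_ (∑-cong< (suc x) (λ a a≤x → cong F (sym (+-∸-assoc 1 (s≤s⁻¹ a≤x)))))
                 (cong F (sym (n∸n≡0 (suc x)))) ⟩
  ∑ (suc x) (λ a → F (suc x ∸ a)) + F (suc x ∸ suc x)
    ≡⟨ ∑-last (suc x) (λ a → F (suc x ∸ a)) ⟨
  ∑ (suc (suc x)) (λ a → F (suc x ∸ a)) ∎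

∑-triangle : ∀ x (H : ℕ → ℕ → ℕ) →
  ∑ (suc x) (λ a → ∑ (suc a) (H a)) ≡ ∑ (suc x) (λ b → ∑ (suc (x ∸ b)) (λ c → H (b + c) b))
∑-triangle zero    H = refl
∑-triangle (suc x) H = begin
  (H 0 0 + 0) + ∑ (suc x) (λ a → H (suc a) 0 + ∑ (suc a) (λ b → H (suc a) (suc b)))
    ≡⟨ cong (_+_ (H 0 0 + 0)) (∑-+ (suc x) (λ a → H (suc a) 0) (λ a → ∑ (suc a) (λ b → H (suc a) (suc b)))) ⟩
  (H 0 0 + 0) + (∑ (suc x) (λ a → H (suc a) 0) + ∑ (suc x) (λ a → ∑ (suc a) (λ b → H (suc a) (suc b))))
    ≡⟨ cong (λ z → (H 0 0 + 0) + (∑ (suc x) (λ a → H (suc a) 0) + z)) (∑-triangle x (λ a b → H (suc a) (suc b))) ⟩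
  (H 0 0 + 0) + (∑ (suc x) (λ a → H (suc a) 0) + ∑ (suc x) (λ b → ∑ (suc (x ∸ b)) (λ c → H (suc (b + c)) (suc b))))
    ≡⟨ regroup (H 0 0) _ _ ⟩
  (H 0 0 + ∑ (suc x) (λ a → H (suc a) 0)) + ∑ (suc x) (λ b → ∑ (suc (x ∸ b)) (λ c → H (suc (b + c)) (suc b))) ∎
  where regroup : ∀ a b c → (a + 0) + (b + c) ≡ (a + b) + c
        regroup = solve-∀

-- 0/1-valued indicators carry side conditions as factors inside sums.

𝟙≡ : ℕ → ℕ → ℕ
𝟙≡ zero    zero    = 1
𝟙≡ zero    (suc _) = 0
𝟙≡ (suc _) zero    = 0
𝟙≡ (suc a) (suc b) = 𝟙≡ a b

𝟙≤ : ℕ → ℕ → ℕ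
𝟙≤ zero    _       = 1
𝟙≤ (suc _) zero    = 0
𝟙≤ (suc a) (suc b) = 𝟙≤ a b

𝟙≡-refl : ∀ a → 𝟙≡ a a ≡ 1
𝟙≡-refl zero    = refl
𝟙≡-refl (suc a) = 𝟙≡-refl a

𝟙≡-≢ : ∀ {a b} → ¬ a ≡ b → 𝟙≡ a b ≡ 0
𝟙≡-≢ {zero}  {zero}  a≢b = ⊥-elim (a≢b refl)
𝟙≡-≢ {zero}  {suc b} a≢b = refl
𝟙≡-≢ {suc a} {zero}  a≢b = refl
𝟙≡-≢ {suc a} {suc b} a≢b = 𝟙≡-≢ (λ a≡b → a≢b (cong suc a≡b))

𝟙≡-sym : ∀ a b → 𝟙≡ a b ≡ 𝟙≡ b a
𝟙≡-sym zero    zero    = refl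
𝟙≡-sym zero    (suc b) = refl
𝟙≡-sym (suc a) zero    = refl
𝟙≡-sym (suc a) (suc b) = 𝟙≡-sym a b

𝟙≡-*-subst : ∀ a b (F : ℕ → ℕ) → 𝟙≡ a b * F a ≡ 𝟙≡ a b * F b
𝟙≡-*-subst a b F with a ≟ b
... | yes refl = refl
... | no  a≢b  rewrite 𝟙≡-≢ a≢b = refl

𝟙≡-+ : ∀ a b c → 𝟙≡ (a + b) c ≡ 𝟙≤ a c * 𝟙≡ b (c ∸ a)
𝟙≡-+ zero    b c       = sym (+-identityʳ _)
𝟙≡-+ (suc a) b zero    = refl
𝟙≡-+ (suc a) b (suc c) = 𝟙≡-+ a b c

𝟙≤-≤ : ∀ {a b} → a ≤ b → 𝟙≤ a b ≡ 1
𝟙≤-≤ {zero}              _         = refl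
𝟙≤-≤ {suc a} {suc b} (s≤s a≤b) = 𝟙≤-≤ a≤b

≤⊎𝟙≤≡0 : ∀ a b → a ≤ b ⊎ 𝟙≤ a b ≡ 0
≤⊎𝟙≤≡0 zero    b       = inj₁ z≤n
≤⊎𝟙≤≡0 (suc a) zero    = inj₂ refl
≤⊎𝟙≤≡0 (suc a) (suc b) with ≤⊎𝟙≤≡0 a b
... | inj₁ a≤b = inj₁ (s≤s a≤b)
... | inj₂ e   = inj₂ e

∑-truncate : ∀ y n (F : ℕ → ℕ) → y < n → ∑ n (λ a → 𝟙≤ a y * F a) ≡ ∑ (suc y) F
∑-truncate zero    (suc n) F _         = cong₂ _+_ (+-identityʳ (F 0)) (∑-0 n (λ _ → refl))
∑-truncate (suc y) (suc n) F (s≤s y<n) = cong₂ _+_ (+-identityʳ (F 0)) (∑-truncate y n (λ a → F (suc a)) y<n)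

∑-𝟙≡ : ∀ n b (F : ℕ → ℕ) → ∑ n (λ a → 𝟙≡ b a * F a) ≡ 𝟙≤ (suc b) n * F b
∑-𝟙≡ zero    b       F = refl
∑-𝟙≡ (suc n) zero    F = trans (cong (_+_ (1 * F 0)) (∑-0 n (λ _ → refl))) (+-identityʳ _)
∑-𝟙≡ (suc n) (suc b) F = ∑-𝟙≡ n b (λ a → F (suc a))

infix 4 _≤ᵛ_
_≤ᵛ_ : ∀ {N} → Vec ℕ N → Vec ℕ N → Set
_≤ᵛ_ = Pointwise _≤_

≤ᵛ-refl : ∀ {N} {v : Vec ℕ N} → v ≤ᵛ v
≤ᵛ-refl = Pointwise.refl ≤-refl

≤ᵛ-trans : ∀ {N} {u v w : Vec ℕ N} → u ≤ᵛ v → v ≤ᵛ w → u ≤ᵛ w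
≤ᵛ-trans = Pointwise.trans ≤-trans

𝟎≤ᵛ : ∀ {N} (v : Vec ℕ N) → 𝟎 ≤ᵛ v
𝟎≤ᵛ []      = []
𝟎≤ᵛ (x ∷ v) = z≤n ∷ 𝟎≤ᵛ v

infixl 6 _∸ᵛ_
_∸ᵛ_ : ∀ {N} → Vec ℕ N → Vec ℕ N → Vec ℕ N
_∸ᵛ_ = zipWith _∸_

∸ᵛ-≤ᵛ : ∀ {N} (v s : Vec ℕ N) → v ∸ᵛ s ≤ᵛ v
∸ᵛ-≤ᵛ []      []      = []
∸ᵛ-≤ᵛ (x ∷ v) (a ∷ s) = m∸n≤m x a ∷ ∸ᵛ-≤ᵛ v s

∸ᵛ-𝟎 : ∀ {N} (v : Vec ℕ N) → v ∸ᵛ 𝟎 ≡ v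
∸ᵛ-𝟎 []      = refl
∸ᵛ-𝟎 (x ∷ v) = cong (x ∷_) (∸ᵛ-𝟎 v)

∸ᵛ-∸ᵛ : ∀ {N} {s v : Vec ℕ N} → s ≤ᵛ v → v ∸ᵛ (v ∸ᵛ s) ≡ s
∸ᵛ-∸ᵛ []         = refl
∸ᵛ-∸ᵛ (a≤b ∷ s≤v) = cong₂ _∷_ (m∸[m∸n]≡n a≤b) (∸ᵛ-∸ᵛ s≤v)

⊕-∸ᵛ : ∀ {N} (t u : Vec ℕ N) → (t ⊕ u) ∸ᵛ t ≡ u
⊕-∸ᵛ []      []      = refl
⊕-∸ᵛ (a ∷ t) (b ∷ u) = cong₂ _∷_ (m+n∸m≡n a b) (⊕-∸ᵛ t u)

∸ᵛ-⊕ : ∀ {N} (v t u : Vec ℕ N) → v ∸ᵛ (t ⊕ u) ≡ v ∸ᵛ t ∸ᵛ u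
∸ᵛ-⊕ []      []      []      = refl
∸ᵛ-⊕ (x ∷ v) (a ∷ t) (b ∷ u) = cong₂ _∷_ (sym (∸-+-assoc x a b)) (∸ᵛ-⊕ v t u)

lookup-∸ᵛ : ∀ {N} {s v : Vec ℕ N} → s ≤ᵛ v → (j : Fin N) → lookup v j ≡ lookup s j + lookup (v ∸ᵛ s) j
lookup-∸ᵛ (a≤b ∷ _)   zero    = sym (m+[n∸m]≡n a≤b)
lookup-∸ᵛ (_   ∷ s≤v) (suc j) = lookup-∸ᵛ s≤v j

0·v : ∀ {N} (u : Vec ℕ N) → 0 ·v u ≡ 𝟎
0·v []      = refl
0·v (x ∷ u) = cong (0 ∷_) (0·v u)

suc·v : ∀ {N} i (u : Vec ℕ N) → suc i ·v u ≡ u ⊕ (i ·v u)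
suc·v i []      = refl
suc·v i (x ∷ u) = cong (x + i * x ∷_) (suc·v i u)

𝟙≡ᵛ : ∀ {N} → Vec ℕ N → Vec ℕ N → ℕ
𝟙≡ᵛ []       []       = 1
𝟙≡ᵛ (a ∷ as) (b ∷ bs) = 𝟙≡ a b * 𝟙≡ᵛ as bs

𝟙≤ᵛ : ∀ {N} → Vec ℕ N → Vec ℕ N → ℕ
𝟙≤ᵛ []       []       = 1
𝟙≤ᵛ (a ∷ as) (b ∷ bs) = 𝟙≤ a b * 𝟙≤ᵛ as bs

𝟙≡ᵛ-refl : ∀ {N} (v : Vec ℕ N) → 𝟙≡ᵛ v v ≡ 1
𝟙≡ᵛ-refl []      = refl
𝟙≡ᵛ-refl (a ∷ v) rewrite 𝟙≡-refl a | 𝟙≡ᵛ-refl v = refl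

𝟙≡ᵛ-sym : ∀ {N} (v w : Vec ℕ N) → 𝟙≡ᵛ v w ≡ 𝟙≡ᵛ w v
𝟙≡ᵛ-sym []      []      = refl
𝟙≡ᵛ-sym (a ∷ v) (b ∷ w) = cong₂ _*_ (𝟙≡-sym a b) (𝟙≡ᵛ-sym v w)

𝟙≡ᵛ-≢ : ∀ {N} {v w : Vec ℕ N} → ¬ v ≡ w → 𝟙≡ᵛ v w ≡ 0
𝟙≡ᵛ-≢ {v = []}    {[]}    v≢w = ⊥-elim (v≢w refl)
𝟙≡ᵛ-≢ {v = a ∷ v} {b ∷ w} v≢w with a ≟ b
... | no  a≢b  rewrite 𝟙≡-≢ a≢b = refl
... | yes refl rewrite 𝟙≡ᵛ-≢ {v = v} {w} (λ v≡w → v≢w (cong (a ∷_) v≡w)) = *-zeroʳ (𝟙≡ a a)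

𝟙≤ᵛ-≤ᵛ : ∀ {N} {v w : Vec ℕ N} → v ≤ᵛ w → 𝟙≤ᵛ v w ≡ 1
𝟙≤ᵛ-≤ᵛ []          = refl
𝟙≤ᵛ-≤ᵛ (a≤b ∷ v≤w) rewrite 𝟙≤-≤ a≤b | 𝟙≤ᵛ-≤ᵛ v≤w = refl

≤ᵛ⊎𝟙≤ᵛ≡0 : ∀ {N} (v w : Vec ℕ N) → v ≤ᵛ w ⊎ 𝟙≤ᵛ v w ≡ 0
≤ᵛ⊎𝟙≤ᵛ≡0 []      []      = inj₁ []
≤ᵛ⊎𝟙≤ᵛ≡0 (a ∷ v) (b ∷ w) with ≤⊎𝟙≤≡0 a b | ≤ᵛ⊎𝟙≤ᵛ≡0 v w
... | inj₂ e   | _        rewrite e = inj₂ refl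
... | inj₁ a≤b | inj₂ e   rewrite e = inj₂ (*-zeroʳ (𝟙≤ a b))
... | inj₁ a≤b | inj₁ v≤w = inj₁ (a≤b ∷ v≤w)

𝟙≡ᵛ-⊕ : ∀ {N} (u v w : Vec ℕ N) → 𝟙≡ᵛ (u ⊕ v) w ≡ 𝟙≤ᵛ u w * 𝟙≡ᵛ v (w ∸ᵛ u)
𝟙≡ᵛ-⊕ []      []      []      = refl
𝟙≡ᵛ-⊕ (a ∷ u) (b ∷ v) (c ∷ w) = begin
  𝟙≡ (a + b) c * 𝟙≡ᵛ (u ⊕ v) w
    ≡⟨ cong₂ _*_ (𝟙≡-+ a b c) (𝟙≡ᵛ-⊕ u v w) ⟩
  (𝟙≤ a c * 𝟙≡ b (c ∸ a)) * (𝟙≤ᵛ u w * 𝟙≡ᵛ v (w ∸ᵛ u))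
    ≡⟨ *-CS.interchange (𝟙≤ a c) _ _ _ ⟩
  (𝟙≤ a c * 𝟙≤ᵛ u w) * (𝟙≡ b (c ∸ a) * 𝟙≡ᵛ v (w ∸ᵛ u)) ∎

∑≤ : ∀ {N} → Vec ℕ N → (Vec ℕ N → ℕ) → ℕ
∑≤ []       F = F []
∑≤ (x ∷ xs) F = ∑ (suc x) (λ a → ∑≤ xs (λ t → F (a ∷ t)))

∑≤-cong≤ : ∀ {N} (ℓ : Vec ℕ N) {F G : Vec ℕ N → ℕ} → (∀ s → s ≤ᵛ ℓ → F s ≡ G s) → ∑≤ ℓ F ≡ ∑≤ ℓ G
∑≤-cong≤ []       F≡G = F≡G [] []
∑≤-cong≤ (x ∷ xs) F≡G = ∑-cong< (suc x) (λ a a≤x → ∑≤-cong≤ xs (λ t t≤xs → F≡G (a ∷ t) (s≤s⁻¹ a≤x ∷ t≤xs)))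

∑≤-cong : ∀ {N} (ℓ : Vec ℕ N) {F G : Vec ℕ N → ℕ} → (∀ s → F s ≡ G s) → ∑≤ ℓ F ≡ ∑≤ ℓ G
∑≤-cong ℓ F≡G = ∑≤-cong≤ ℓ (λ s _ → F≡G s)

∑≤-0 : ∀ {N} (ℓ : Vec ℕ N) {F : Vec ℕ N → ℕ} → (∀ s → F s ≡ 0) → ∑≤ ℓ F ≡ 0
∑≤-0 []       F≡0 = F≡0 []
∑≤-0 (x ∷ xs) F≡0 = ∑-0 (suc x) (λ a → ∑≤-0 xs (λ t → F≡0 (a ∷ t)))

∑≤-+ : ∀ {N} (ℓ : Vec ℕ N) (F G : Vec ℕ N → ℕ) → ∑≤ ℓ (λ s → F s + G s) ≡ ∑≤ ℓ F + ∑≤ ℓ G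
∑≤-+ []       F G = refl
∑≤-+ (x ∷ xs) F G = trans (∑-cong (suc x) (λ a → ∑≤-+ xs (λ t → F (a ∷ t)) (λ t → G (a ∷ t))))
                          (∑-+ (suc x) (λ a → ∑≤ xs (λ t → F (a ∷ t))) (λ a → ∑≤ xs (λ t → G (a ∷ t))))

∑≤-*ˡ : ∀ {N} (ℓ : Vec ℕ N) c (F : Vec ℕ N → ℕ) → ∑≤ ℓ (λ s → c * F s) ≡ c * ∑≤ ℓ F
∑≤-*ˡ []       c F = refl
∑≤-*ˡ (x ∷ xs) c F = trans (∑-cong (suc x) (λ a → ∑≤-*ˡ xs c (λ t → F (a ∷ t))))
                           (∑-*ˡ (suc x) c (λ a → ∑≤ xs (λ t → F (a ∷ t))))

∑≤-*ʳ : ∀ {N} (ℓ : Vec ℕ N) c (F : Vec ℕ N → ℕ) → ∑≤ ℓ (λ s → F s * c) ≡ ∑≤ ℓ F * c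
∑≤-*ʳ ℓ c F = begin
  ∑≤ ℓ (λ s → F s * c) ≡⟨ ∑≤-cong ℓ (λ s → *-comm (F s) c) ⟩
  ∑≤ ℓ (λ s → c * F s) ≡⟨ ∑≤-*ˡ ℓ c F ⟩
  c * ∑≤ ℓ F           ≡⟨ *-comm c _ ⟩
  ∑≤ ℓ F * c           ∎

∑≤-∑-comm : ∀ {N} (ℓ : Vec ℕ N) n (F : Vec ℕ N → ℕ → ℕ) →
  ∑≤ ℓ (λ s → ∑ n (F s)) ≡ ∑ n (λ a → ∑≤ ℓ (λ s → F s a))
∑≤-∑-comm []       n F = refl
∑≤-∑-comm (x ∷ xs) n F = trans (∑-cong (suc x) (λ b → ∑≤-∑-comm xs n (λ t → F (b ∷ t))))
                               (∑-comm (suc x) n (λ b a → ∑≤ xs (λ t → F (b ∷ t) a)))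

∑≤-reverse : ∀ {N} (ℓ : Vec ℕ N) (F : Vec ℕ N → ℕ) → ∑≤ ℓ F ≡ ∑≤ ℓ (λ s → F (ℓ ∸ᵛ s))
∑≤-reverse []       F = refl
∑≤-reverse (x ∷ xs) F = trans (∑-reverse x (λ a → ∑≤ xs (λ t → F (a ∷ t))))
                              (∑-cong (suc x) (λ a → ∑≤-reverse xs (λ t → F ((x ∸ a) ∷ t))))

∑≤-triangle : ∀ {N} (v : Vec ℕ N) (G : Vec ℕ N → Vec ℕ N → ℕ) →
  ∑≤ v (λ s → ∑≤ s (G s)) ≡ ∑≤ v (λ t → ∑≤ (v ∸ᵛ t) (λ u → G (t ⊕ u) t))
∑≤-triangle []       G = refl
∑≤-triangle (x ∷ xs) G = begin
  ∑ (suc x) (λ a → ∑≤ xs (λ s → ∑ (suc a) (λ b → ∑≤ s (λ t → G (a ∷ s) (b ∷ t)))))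
    ≡⟨ ∑-cong (suc x) (λ a → ∑≤-∑-comm xs (suc a) (λ s b → ∑≤ s (λ t → G (a ∷ s) (b ∷ t)))) ⟩
  ∑ (suc x) (λ a → ∑ (suc a) (λ b → ∑≤ xs (λ s → ∑≤ s (λ t → G (a ∷ s) (b ∷ t)))))
    ≡⟨ ∑-cong (suc x) (λ a → ∑-cong (suc a) (λ b → ∑≤-triangle xs (λ s t → G (a ∷ s) (b ∷ t)))) ⟩
  ∑ (suc x) (λ a → ∑ (suc a) (λ b → H a b))
    ≡⟨ ∑-triangle x H ⟩
  ∑ (suc x) (λ b → ∑ (suc (x ∸ b)) (λ c → H (b + c) b))
    ≡⟨ ∑-cong (suc x) (λ b → ∑≤-∑-comm xs (suc (x ∸ b)) (λ t c → ∑≤ (xs ∸ᵛ t) (λ u → G ((b + c) ∷ (t ⊕ u)) (b ∷ t)))) ⟨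
  ∑ (suc x) (λ b → ∑≤ xs (λ t → ∑ (suc (x ∸ b)) (λ c → ∑≤ (xs ∸ᵛ t) (λ u → G ((b + c) ∷ (t ⊕ u)) (b ∷ t))))) ∎
  where H : ℕ → ℕ → ℕ
        H a b = ∑≤ xs (λ t → ∑≤ (xs ∸ᵛ t) (λ u → G (a ∷ (t ⊕ u)) (b ∷ t)))

∑≤-truncate : ∀ {N} (ℓ₀ ℓ : Vec ℕ N) (F : Vec ℕ N → ℕ) → ℓ ≤ᵛ ℓ₀ → ∑≤ ℓ₀ (λ s → 𝟙≤ᵛ s ℓ * F s) ≡ ∑≤ ℓ F
∑≤-truncate []       []       F []          = +-identityʳ (F [])
∑≤-truncate (x ∷ xs) (y ∷ ys) F (y≤x ∷ ys≤xs) = begin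
  ∑ (suc x) (λ a → ∑≤ xs (λ t → (𝟙≤ a y * 𝟙≤ᵛ t ys) * F (a ∷ t)))
    ≡⟨ ∑-cong (suc x) (λ a → trans (∑≤-cong xs (λ t → *-assoc (𝟙≤ a y) (𝟙≤ᵛ t ys) (F (a ∷ t))))
                                   (∑≤-*ˡ xs (𝟙≤ a y) (λ t → 𝟙≤ᵛ t ys * F (a ∷ t)))) ⟩
  ∑ (suc x) (λ a → 𝟙≤ a y * ∑≤ xs (λ t → 𝟙≤ᵛ t ys * F (a ∷ t)))
    ≡⟨ ∑-cong (suc x) (λ a → cong (𝟙≤ a y *_) (∑≤-truncate xs ys (λ t → F (a ∷ t)) ys≤xs)) ⟩
  ∑ (suc x) (λ a → 𝟙≤ a y * ∑≤ ys (λ t → F (a ∷ t)))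
    ≡⟨ ∑-truncate y (suc x) (λ a → ∑≤ ys (λ t → F (a ∷ t))) (s≤s y≤x) ⟩
  ∑ (suc y) (λ a → ∑≤ ys (λ t → F (a ∷ t))) ∎

∑≤-𝟙≡ᵛ : ∀ {N} (v u : Vec ℕ N) (F : Vec ℕ N → ℕ) → ∑≤ v (λ s → 𝟙≡ᵛ u s * F s) ≡ 𝟙≤ᵛ u v * F u
∑≤-𝟙≡ᵛ []       []      F = refl
∑≤-𝟙≡ᵛ (x ∷ xs) (b ∷ u) F = begin
  ∑ (suc x) (λ a → ∑≤ xs (λ t → (𝟙≡ b a * 𝟙≡ᵛ u t) * F (a ∷ t)))
    ≡⟨ ∑-cong (suc x) (λ a → trans (∑≤-cong xs (λ t → *-assoc (𝟙≡ b a) (𝟙≡ᵛ u t) (F (a ∷ t))))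
                                   (∑≤-*ˡ xs (𝟙≡ b a) (λ t → 𝟙≡ᵛ u t * F (a ∷ t)))) ⟩
  ∑ (suc x) (λ a → 𝟙≡ b a * ∑≤ xs (λ t → 𝟙≡ᵛ u t * F (a ∷ t)))
    ≡⟨ ∑-cong (suc x) (λ a → cong (𝟙≡ b a *_) (∑≤-𝟙≡ᵛ xs u (λ t → F (a ∷ t)))) ⟩
  ∑ (suc x) (λ a → 𝟙≡ b a * (𝟙≤ᵛ u xs * F (a ∷ u)))
    ≡⟨ ∑-𝟙≡ (suc x) b (λ a → 𝟙≤ᵛ u xs * F (a ∷ u)) ⟩
  𝟙≤ b x * (𝟙≤ᵛ u xs * F (b ∷ u))
    ≡⟨ *-assoc (𝟙≤ b x) _ _ ⟨
  𝟙≤ b x * 𝟙≤ᵛ u xs * F (b ∷ u) ∎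

-- A series Σᵥ A(v) xᵛ is represented by its coefficient function.
Series : ℕ → Set
Series N = Vec ℕ N → ℕ

infix 4 _≈_
_≈_ : ∀ {N} → Series N → Series N → Set
A ≈ B = ∀ v → A v ≡ B v

infixl 6 _⊞_
_⊞_ : ∀ {N} → Series N → Series N → Series N
(A ⊞ B) v = A v + B v

infixr 7 _⊙_
_⊙_ : ∀ {N} → ℕ → Series N → Series N
(c ⊙ A) v = c * A v

infixl 7 _⋆_
_⋆_ : ∀ {N} → Series N → Series N → Series N
(A ⋆ B) v = ∑≤ v (λ s → A s * B (v ∸ᵛ s))

0ˢ : ∀ {N} → Series N
0ˢ _ = 0

δ : ∀ {N} → Vec ℕ N → Series N
δ = 𝟙≡ᵛ

1ˢ : ∀ {N} → Series N
1ˢ = δ 𝟎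

≈-isEquivalence : ∀ {N} → IsEquivalence (_≈_ {N})
≈-isEquivalence = PointwiseAlgebra.isEquivalence _ ≡.isEquivalence

≈-refl : ∀ {N} {A : Series N} → A ≈ A
≈-refl _ = refl

≈-sym : ∀ {N} {A B : Series N} → A ≈ B → B ≈ A
≈-sym A≈B v = sym (A≈B v)

≈-trans : ∀ {N} {A B C : Series N} → A ≈ B → B ≈ C → A ≈ C
≈-trans A≈B B≈C v = trans (A≈B v) (B≈C v)

⋆-cong : ∀ {N} {A A′ B B′ : Series N} → A ≈ A′ → B ≈ B′ → A ⋆ B ≈ A′ ⋆ B′
⋆-cong A≈A′ B≈B′ v = ∑≤-cong v (λ s → cong₂ _*_ (A≈A′ s) (B≈B′ (v ∸ᵛ s)))

⋆-congˡ : ∀ {N} {A A′ : Series N} (B : Series N) → A ≈ A′ → A ⋆ B ≈ A′ ⋆ B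
⋆-congˡ B A≈A′ = ⋆-cong A≈A′ (≈-refl {A = B})

⋆-congʳ : ∀ {N} (A : Series N) {B B′ : Series N} → B ≈ B′ → A ⋆ B ≈ A ⋆ B′
⋆-congʳ A = ⋆-cong (≈-refl {A = A})

⋆-comm : ∀ {N} (A B : Series N) → A ⋆ B ≈ B ⋆ A
⋆-comm A B v = begin
  ∑≤ v (λ s → A s * B (v ∸ᵛ s))                 ≡⟨ ∑≤-reverse v (λ s → A s * B (v ∸ᵛ s)) ⟩
  ∑≤ v (λ s → A (v ∸ᵛ s) * B (v ∸ᵛ (v ∸ᵛ s)))  ≡⟨ ∑≤-cong≤ v (λ s s≤v → trans (cong (λ t → A (v ∸ᵛ s) * B t) (∸ᵛ-∸ᵛ s≤v))
                                                                           (*-comm (A (v ∸ᵛ s)) (B s))) ⟩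
  ∑≤ v (λ s → B s * A (v ∸ᵛ s))                 ∎

⋆-assoc : ∀ {N} (A B C : Series N) → (A ⋆ B) ⋆ C ≈ A ⋆ (B ⋆ C)
⋆-assoc A B C v = begin
  ∑≤ v (λ s → ∑≤ s (λ t → A t * B (s ∸ᵛ t)) * C (v ∸ᵛ s))
    ≡⟨ ∑≤-cong v (λ s → ∑≤-*ʳ s (C (v ∸ᵛ s)) (λ t → A t * B (s ∸ᵛ t))) ⟨
  ∑≤ v (λ s → ∑≤ s (λ t → A t * B (s ∸ᵛ t) * C (v ∸ᵛ s)))
    ≡⟨ ∑≤-triangle v (λ s t → A t * B (s ∸ᵛ t) * C (v ∸ᵛ s)) ⟩
  ∑≤ v (λ t → ∑≤ (v ∸ᵛ t) (λ u → A t * B (t ⊕ u ∸ᵛ t) * C (v ∸ᵛ (t ⊕ u))))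
    ≡⟨ ∑≤-cong v (λ t → ∑≤-cong (v ∸ᵛ t) (λ u →
         trans (cong₂ (λ p q → A t * B p * C q) (⊕-∸ᵛ t u) (∸ᵛ-⊕ v t u)) (*-assoc (A t) _ _))) ⟩
  ∑≤ v (λ t → ∑≤ (v ∸ᵛ t) (λ u → A t * (B u * C (v ∸ᵛ t ∸ᵛ u))))
    ≡⟨ ∑≤-cong v (λ t → ∑≤-*ˡ (v ∸ᵛ t) (A t) (λ u → B u * C (v ∸ᵛ t ∸ᵛ u))) ⟩
  ∑≤ v (λ t → A t * ∑≤ (v ∸ᵛ t) (λ u → B u * C (v ∸ᵛ t ∸ᵛ u))) ∎

δ⋆-apply : ∀ {N} (u : Vec ℕ N) (H : Series N) v → (δ u ⋆ H) v ≡ 𝟙≤ᵛ u v * H (v ∸ᵛ u)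
δ⋆-apply u H v = ∑≤-𝟙≡ᵛ v u (λ s → H (v ∸ᵛ s))

⋆-identityˡ : ∀ {N} (A : Series N) → 1ˢ ⋆ A ≈ A
⋆-identityˡ A v = begin
  (1ˢ ⋆ A) v          ≡⟨ δ⋆-apply 𝟎 A v ⟩
  𝟙≤ᵛ 𝟎 v * A (v ∸ᵛ 𝟎) ≡⟨ cong₂ _*_ (𝟙≤ᵛ-≤ᵛ (𝟎≤ᵛ v)) (cong A (∸ᵛ-𝟎 v)) ⟩
  1 * A v             ≡⟨ *-identityˡ (A v) ⟩
  A v                 ∎

⋆-zeroˡ : ∀ {N} (A : Series N) → 0ˢ ⋆ A ≈ 0ˢ
⋆-zeroˡ A v = ∑≤-0 v (λ _ → refl)

⋆-distribʳ : ∀ {N} (C A B : Series N) → (A ⊞ B) ⋆ C ≈ A ⋆ C ⊞ B ⋆ C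
⋆-distribʳ C A B v = trans (∑≤-cong v (λ s → *-distribʳ-+ (C (v ∸ᵛ s)) (A s) (B s))) (∑≤-+ v _ _)

⊙-⋆ : ∀ {N} c (A B : Series N) → (c ⊙ A) ⋆ B ≈ c ⊙ (A ⋆ B)
⊙-⋆ c A B v = trans (∑≤-cong v (λ s → *-assoc c (A s) _)) (∑≤-*ˡ v c _)

⋆-⊙ : ∀ {N} c (A B : Series N) → A ⋆ (c ⊙ B) ≈ c ⊙ (A ⋆ B)
⋆-⊙ c A B v = trans (∑≤-cong v (λ s → *-CS.x∙yz≈y∙xz (A s) c _)) (∑≤-*ˡ v c _)

δ⋆δ : ∀ {N} (u w : Vec ℕ N) → δ u ⋆ δ w ≈ δ (u ⊕ w)
δ⋆δ u w v = trans (δ⋆-apply u (δ w) v) (sym (𝟙≡ᵛ-⊕ u w v))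

⋆-isCommutativeMonoid : ∀ {N} → IsCommutativeMonoid (_≈_ {N}) _⋆_ 1ˢ
⋆-isCommutativeMonoid = Biased.isCommutativeMonoidˡ record
  { isSemigroup = record
    { isMagma = record { isEquivalence = ≈-isEquivalence ; ∙-cong = ⋆-cong }
    ; assoc   = ⋆-assoc
    }
  ; identityˡ = ⋆-identityˡ
  ; comm      = ⋆-comm
  }

⊞-⋆-commutativeSemiring : ℕ → CommutativeSemiring 0ℓ 0ℓ
⊞-⋆-commutativeSemiring N = record
  { isCommutativeSemiring = Biased.isCommutativeSemiringˡ record
    { +-isCommutativeMonoid = PointwiseAlgebra.isCommutativeMonoid (Vec ℕ N) +-0-isCommutativeMonoid
    ; *-isCommutativeMonoid = ⋆-isCommutativeMonoid
    ; distribʳ              = ⋆-distribʳ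
    ; zeroˡ                 = ⋆-zeroˡ
    }
  }

module SeriesExp (N : ℕ) = Exp (CommutativeSemiring.semiring (⊞-⋆-commutativeSemiring N))
module SeriesBinomial (N : ℕ) = Binomial (⊞-⋆-commutativeSemiring N)
module SeriesOps (N : ℕ) = RawSemiringOps (CommutativeSemiring.rawSemiring (⊞-⋆-commutativeSemiring N))

infixr 8 _^ˢ_
_^ˢ_ : ∀ {N} → Series N → ℕ → Series N
_^ˢ_ {N} = SeriesOps._^_ N

^ˢ-cong : ∀ {N} {A B : Series N} k → A ≈ B → A ^ˢ k ≈ B ^ˢ k
^ˢ-cong {N} k A≈B = SeriesExp.^-congˡ N k A≈B

^ˢ-+ : ∀ {N} (A : Series N) m n → A ^ˢ (m + n) ≈ A ^ˢ m ⋆ A ^ˢ n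
^ˢ-+ {N} = SeriesExp.^-homo-* N

∑-×-apply : ∀ {N} n (c : ℕ → ℕ) (T : ℕ → Series N) v →
  SeriesOps.sum N (λ (j : Fin n) → SeriesOps._×_ N (c (toℕ j)) (T (toℕ j))) v ≡ ∑ n (λ i → c i * T i v)
∑-×-apply zero    c T v = refl
∑-×-apply {N} (suc n) c T v = cong₂ _+_ (×-apply (c 0)) (∑-×-apply n (λ i → c (suc i)) (λ i → T (suc i)) v)
  where ×-apply : ∀ m → SeriesOps._×_ N m (T 0) v ≡ m * T 0 v
        ×-apply zero    = refl
        ×-apply (suc m) = cong (_+_ (T 0 v)) (×-apply m)

binomial-theorem : ∀ {N} (A B : Series N) k v →
  ((A ⊞ B) ^ˢ k) v ≡ ∑ (suc k) (λ i → (k C i) * (A ^ˢ i ⋆ B ^ˢ (k ∸ i)) v)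
binomial-theorem {N} A B k v =
  trans (SeriesBinomial.theorem N k A B v) (∑-×-apply (suc k) (k C_) (λ i → A ^ˢ i ⋆ B ^ˢ (k ∸ i)) v)

^ˢ-monomial : ∀ {N} c (u : Vec ℕ N) i → (c ⊙ δ u) ^ˢ i ≈ (c ^ i) ⊙ δ (i ·v u)
^ˢ-monomial c u zero    v = sym (trans (*-identityˡ _) (cong (λ w → 𝟙≡ᵛ w v) (0·v u)))
^ˢ-monomial c u (suc i) v = begin
  ((c ⊙ δ u) ⋆ (c ⊙ δ u) ^ˢ i) v             ≡⟨ ⋆-congʳ (c ⊙ δ u) (^ˢ-monomial c u i) v ⟩
  ((c ⊙ δ u) ⋆ ((c ^ i) ⊙ δ (i ·v u))) v     ≡⟨ ⊙-⋆ c (δ u) ((c ^ i) ⊙ δ (i ·v u)) v ⟩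
  c * (δ u ⋆ ((c ^ i) ⊙ δ (i ·v u))) v       ≡⟨ cong (c *_) (⋆-⊙ (c ^ i) (δ u) (δ (i ·v u)) v) ⟩
  c * (c ^ i * (δ u ⋆ δ (i ·v u)) v)         ≡⟨ *-assoc c _ _ ⟨
  c ^ suc i * (δ u ⋆ δ (i ·v u)) v           ≡⟨ cong (c ^ suc i *_) (δ⋆δ u (i ·v u) v) ⟩
  c ^ suc i * 𝟙≡ᵛ (u ⊕ (i ·v u)) v           ≡⟨ cong (λ w → c ^ suc i * 𝟙≡ᵛ w v) (suc·v i u) ⟨
  c ^ suc i * 𝟙≡ᵛ (suc i ·v u) v             ∎

monomial^ˢ⋆-apply : ∀ {N} c (u : Vec ℕ N) i (H : Series N) w →
  ((c ⊙ δ u) ^ˢ i ⋆ H) w ≡ c ^ i * (𝟙≤ᵛ (i ·v u) w * H (w ∸ᵛ (i ·v u)))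
monomial^ˢ⋆-apply c u i H w = begin
  ((c ⊙ δ u) ^ˢ i ⋆ H) w             ≡⟨ ⋆-congˡ H (^ˢ-monomial c u i) w ⟩
  (((c ^ i) ⊙ δ (i ·v u)) ⋆ H) w     ≡⟨ ⊙-⋆ (c ^ i) (δ (i ·v u)) H w ⟩
  c ^ i * (δ (i ·v u) ⋆ H) w         ≡⟨ cong (c ^ i *_) (δ⋆-apply (i ·v u) H w) ⟩
  c ^ i * (𝟙≤ᵛ (i ·v u) w * H (w ∸ᵛ (i ·v u))) ∎

∑∈ : ∀ {A : Set} → List A → (A → ℕ) → ℕ
∑∈ xs F = sumℕ (map F xs)

∑∈-cong : ∀ {A : Set} (xs : List A) {F G : A → ℕ} → (∀ x → F x ≡ G x) → ∑∈ xs F ≡ ∑∈ xs G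
∑∈-cong xs F≗G = cong sumℕ (map-cong F≗G xs)

∑∈-*ˡ : ∀ {A : Set} (xs : List A) c (F : A → ℕ) → ∑∈ xs (λ x → c * F x) ≡ c * ∑∈ xs F
∑∈-*ˡ []       c F = sym (*-zeroʳ c)
∑∈-*ˡ (x ∷ xs) c F = trans (cong (_+_ (c * F x)) (∑∈-*ˡ xs c F)) (sym (*-distribˡ-+ c (F x) _))

∑∈-concatMap : ∀ {A B : Set} (g : A → List B) (xs : List A) (F : B → ℕ) →
  ∑∈ (concatMap g xs) F ≡ ∑∈ xs (λ x → ∑∈ (g x) F)
∑∈-concatMap g []       F = refl
∑∈-concatMap g (x ∷ xs) F = begin
  sumℕ (map F (g x ++ concatMap g xs))              ≡⟨ cong sumℕ (map-++ F (g x) (concatMap g xs)) ⟩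
  sumℕ (map F (g x) ++ map F (concatMap g xs))      ≡⟨ sum-++ (map F (g x)) _ ⟩
  ∑∈ (g x) F + ∑∈ (concatMap g xs) F                ≡⟨ cong (_+_ (∑∈ (g x) F)) (∑∈-concatMap g xs F) ⟩
  ∑∈ (g x) F + ∑∈ xs (λ y → ∑∈ (g y) F)             ∎

∑∈-concatMap-∷ : ∀ {A : Set} {n} (xs : List A) (ts : List (Vec A n)) (F : Vec A (suc n) → ℕ) →
  ∑∈ (concatMap (λ a → map (a ∷_) ts) xs) F ≡ ∑∈ xs (λ a → ∑∈ ts (λ t → F (a ∷ t)))
∑∈-concatMap-∷ xs ts F =
  trans (∑∈-concatMap (λ a → map (a ∷_) ts) xs F) (∑∈-cong xs (λ a → cong sumℕ (sym (map-∘ ts))))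

∑∈-applyUpTo : ∀ n (h : ℕ → ℕ) (F : ℕ → ℕ) → ∑∈ (applyUpTo h n) F ≡ ∑ n (λ i → F (h i))
∑∈-applyUpTo zero    h F = refl
∑∈-applyUpTo (suc n) h F = cong (_+_ (F (h 0))) (∑∈-applyUpTo n (λ i → h (suc i)) F)

∑∈-upTo : ∀ n (F : ℕ → ℕ) → ∑∈ (upTo n) F ≡ ∑ n F
∑∈-upTo n = ∑∈-applyUpTo n (λ i → i)

∑∈-box : ∀ {N} (ℓ : Vec ℕ N) (F : Vec ℕ N → ℕ) → ∑∈ (box ℓ) F ≡ ∑≤ ℓ F
∑∈-box []       F = +-identityʳ (F [])
∑∈-box (x ∷ xs) F = begin
  ∑∈ (concatMap (λ a → map (a ∷_) (box xs)) (upTo (suc x))) F ≡⟨ ∑∈-concatMap-∷ (upTo (suc x)) (box xs) F ⟩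
  ∑∈ (upTo (suc x)) (λ a → ∑∈ (box xs) (λ t → F (a ∷ t)))     ≡⟨ ∑∈-cong (upTo (suc x)) (λ a → ∑∈-box xs (λ t → F (a ∷ t))) ⟩
  ∑∈ (upTo (suc x)) (λ a → ∑≤ xs (λ t → F (a ∷ t)))           ≡⟨ ∑∈-upTo (suc x) _ ⟩
  ∑ (suc x) (λ a → ∑≤ xs (λ t → F (a ∷ t)))                   ∎

∑∈-tuples-upTo : ∀ n K (F : Vec ℕ n → ℕ) → ∑∈ (tuples n (upTo (suc K))) F ≡ ∑≤ (replicate n K) F
∑∈-tuples-upTo zero    K F = +-identityʳ (F [])
∑∈-tuples-upTo (suc n) K F = begin
  ∑∈ (concatMap (λ a → map (a ∷_) (tuples n (upTo (suc K)))) (upTo (suc K))) F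
    ≡⟨ ∑∈-concatMap-∷ (upTo (suc K)) (tuples n (upTo (suc K))) F ⟩
  ∑∈ (upTo (suc K)) (λ a → ∑∈ (tuples n (upTo (suc K))) (λ t → F (a ∷ t)))
    ≡⟨ ∑∈-cong (upTo (suc K)) (λ a → ∑∈-tuples-upTo n K (λ t → F (a ∷ t))) ⟩
  ∑∈ (upTo (suc K)) (λ a → ∑≤ (replicate n K) (λ t → F (a ∷ t)))
    ≡⟨ ∑∈-upTo (suc K) _ ⟩
  ∑ (suc K) (λ a → ∑≤ (replicate n K) (λ t → F (a ∷ t))) ∎

∑∈-filter : ∀ {A : Set} {P : A → Set} (P? : ∀ x → Dec (P x)) (xs : List A) (F G : A → ℕ) →
  (∀ x → P x → F x ≡ G x) → (∀ x → ¬ P x → G x ≡ 0) → ∑∈ (filter P? xs) F ≡ ∑∈ xs G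
∑∈-filter P? []       F G F≡G G≡0 = refl
∑∈-filter P? (x ∷ xs) F G F≡G G≡0 with P? x
... | yes p  = cong₂ _+_ (F≡G x p) (∑∈-filter P? xs F G F≡G G≡0)
... | no  ¬p = trans (∑∈-filter P? xs F G F≡G G≡0) (cong (_+ ∑∈ xs G) (sym (G≡0 x ¬p)))

⋆-product : ∀ {N r} → Vec (Series N) r → Series N
⋆-product []       = 1ˢ
⋆-product (g ∷ gs) = g ⋆ ⋆-product gs

product-at : ∀ {N r} → Vec (Series N) r → Vec (Vec ℕ N) r → ℕ
product-at []       []       = 1
product-at (g ∷ gs) (m ∷ ms) = g m * product-at gs ms

-- The enumeration box ℓ₀ stays fixed while the target ℓ shrinks along the induction.
∑∈-tuples-⋆-product : ∀ {N r} (gs : Vec (Series N) r) (ℓ₀ ℓ : Vec ℕ N) → ℓ ≤ᵛ ℓ₀ →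
  ∑∈ (tuples r (box ℓ₀)) (λ ms → 𝟙≡ᵛ (vsum ms) ℓ * product-at gs ms) ≡ ⋆-product gs ℓ
∑∈-tuples-⋆-product []       ℓ₀ ℓ _ = trans (+-identityʳ _) (*-identityʳ _)
∑∈-tuples-⋆-product {r = suc r} (g ∷ gs) ℓ₀ ℓ ℓ≤ℓ₀ = begin
  ∑∈ (tuples (suc r) L) (λ ms → 𝟙≡ᵛ (vsum ms) ℓ * product-at (g ∷ gs) ms)
    ≡⟨ ∑∈-concatMap-∷ L (tuples r L) _ ⟩
  ∑∈ L (λ m → ∑∈ (tuples r L) (λ ms → 𝟙≡ᵛ (m ⊕ vsum ms) ℓ * (g m * product-at gs ms)))
    ≡⟨ ∑∈-cong L split-first ⟩
  ∑∈ L (λ m → 𝟙≤ᵛ m ℓ * (g m * rest m))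
    ≡⟨ ∑∈-cong L (λ m → cong (λ z → 𝟙≤ᵛ m ℓ * (g m * z))
                              (∑∈-tuples-⋆-product gs ℓ₀ (ℓ ∸ᵛ m) (≤ᵛ-trans (∸ᵛ-≤ᵛ ℓ m) ℓ≤ℓ₀))) ⟩
  ∑∈ L (λ m → 𝟙≤ᵛ m ℓ * (g m * ⋆-product gs (ℓ ∸ᵛ m)))
    ≡⟨ ∑∈-box ℓ₀ _ ⟩
  ∑≤ ℓ₀ (λ m → 𝟙≤ᵛ m ℓ * (g m * ⋆-product gs (ℓ ∸ᵛ m)))
    ≡⟨ ∑≤-truncate ℓ₀ ℓ _ ℓ≤ℓ₀ ⟩
  (g ⋆ ⋆-product gs) ℓ ∎
  where
  L = box ℓ₀
  rest : Vec ℕ _ → ℕ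
  rest m = ∑∈ (tuples r L) (λ ms → 𝟙≡ᵛ (vsum ms) (ℓ ∸ᵛ m) * product-at gs ms)
  split-first : ∀ m → ∑∈ (tuples r L) (λ ms → 𝟙≡ᵛ (m ⊕ vsum ms) ℓ * (g m * product-at gs ms))
                      ≡ 𝟙≤ᵛ m ℓ * (g m * rest m)
  split-first m = begin
    ∑∈ (tuples r L) (λ ms → 𝟙≡ᵛ (m ⊕ vsum ms) ℓ * (g m * product-at gs ms))
      ≡⟨ ∑∈-cong (tuples r L) (λ ms → trans (cong (_* (g m * product-at gs ms)) (𝟙≡ᵛ-⊕ m (vsum ms) ℓ))
                                           (*-CS.interchange (𝟙≤ᵛ m ℓ) _ (g m) _)) ⟩
    ∑∈ (tuples r L) (λ ms → (𝟙≤ᵛ m ℓ * g m) * (𝟙≡ᵛ (vsum ms) (ℓ ∸ᵛ m) * product-at gs ms))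
      ≡⟨ ∑∈-*ˡ (tuples r L) (𝟙≤ᵛ m ℓ * g m) _ ⟩
    (𝟙≤ᵛ m ℓ * g m) * rest m
      ≡⟨ *-assoc (𝟙≤ᵛ m ℓ) (g m) (rest m) ⟩
    𝟙≤ᵛ m ℓ * (g m * rest m) ∎

∑∈-tuplesSumming : ∀ {N r} (gs : Vec (Series N) r) (ℓ : Vec ℕ N) →
  ∑∈ (tuplesSumming r ℓ) (product-at gs) ≡ ⋆-product gs ℓ
∑∈-tuplesSumming {r = r} gs ℓ =
  trans (∑∈-filter (λ ms → vsum ms ≟v ℓ) (tuples r (box ℓ)) (product-at gs) _ on-tuplesSumming off-tuplesSumming)
        (∑∈-tuples-⋆-product gs ℓ ℓ ≤ᵛ-refl)
  where
  on-tuplesSumming : ∀ ms → vsum ms ≡ ℓ → product-at gs ms ≡ 𝟙≡ᵛ (vsum ms) ℓ * product-at gs ms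
  on-tuplesSumming ms refl = sym (trans (cong (_* product-at gs ms) (𝟙≡ᵛ-refl ℓ)) (*-identityˡ _))
  off-tuplesSumming : ∀ ms → ¬ vsum ms ≡ ℓ → 𝟙≡ᵛ (vsum ms) ℓ * product-at gs ms ≡ 0
  off-tuplesSumming ms ≢ℓ rewrite 𝟙≡ᵛ-≢ ≢ℓ = refl

⋆-product-replicate : ∀ {N} (A : Series N) k → ⋆-product (replicate k A) ≡ A ^ˢ k
⋆-product-replicate A zero    = refl
⋆-product-replicate A (suc k) = cong (A ⋆_) (⋆-product-replicate A k)

product-at-replicate : ∀ {N k} (f : Series N) (ms : Vec (Vec ℕ N) k) → prodF f ms ≡ product-at (replicate k f) ms
product-at-replicate f []       = refl
product-at-replicate f (m ∷ ms) = cong (f m *_) (product-at-replicate f ms)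

binom≈^ˢ : ∀ {N} (f : Series N) k → binom f k ≈ f ^ˢ k
binom≈^ˢ f k ℓ = begin
  binom f k ℓ                                           ≡⟨ ∑∈-cong (tuplesSumming k ℓ) (product-at-replicate f) ⟩
  ∑∈ (tuplesSumming k ℓ) (product-at (replicate k f))  ≡⟨ ∑∈-tuplesSumming (replicate k f) ℓ ⟩
  ⋆-product (replicate k f) ℓ                           ≡⟨ cong (λ A → A ℓ) (⋆-product-replicate f k) ⟩
  (f ^ˢ k) ℓ                                            ∎

-- Vandermonde convolution and splitting off one value

product-at-binom : ∀ {N r} (f : Series N) (ks : Vec ℕ r) (qs : Vec (Vec ℕ N) r) →
  prodBinom f ks qs ≡ product-at (Vec.map (binom f) ks) qs
product-at-binom f []       []       = refl
product-at-binom f (k ∷ ks) (q ∷ qs) = cong (binom f k q *_) (product-at-binom f ks qs)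

⋆-product-binom : ∀ {N r} (f : Series N) (ks : Vec ℕ r) → ⋆-product (Vec.map (binom f) ks) ≈ f ^ˢ sumV ks
⋆-product-binom f []       = ≈-refl
⋆-product-binom f (k ∷ ks) =
  ≈-trans (⋆-cong (binom≈^ˢ f k) (⋆-product-binom f ks)) (≈-sym (^ˢ-+ f k (sumV ks)))

vandermonde : ∀ {N r} (f : Series N) (ks : Vec ℕ r) (ℓ : Vec ℕ N) →
  binom f (sumV ks) ℓ ≡ sumℕ (map (prodBinom f ks) (tuplesSumming r ℓ))
vandermonde {r = r} f ks ℓ = begin
  binom f (sumV ks) ℓ                                             ≡⟨ binom≈^ˢ f (sumV ks) ℓ ⟩
  (f ^ˢ sumV ks) ℓ                                                ≡⟨ ⋆-product-binom f ks ℓ ⟨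
  ⋆-product (Vec.map (binom f) ks) ℓ                              ≡⟨ ∑∈-tuplesSumming (Vec.map (binom f) ks) ℓ ⟨
  ∑∈ (tuplesSumming r ℓ) (product-at (Vec.map (binom f) ks))     ≡⟨ ∑∈-cong (tuplesSumming r ℓ) (product-at-binom f ks) ⟨
  ∑∈ (tuplesSumming r ℓ) (prodBinom f ks)                         ∎

⊖-≤ᵛ : ∀ {N} {v ℓ : Vec ℕ N} → v ≤ᵛ ℓ → ℓ ⊖ v ≡ toℤv (ℓ ∸ᵛ v)
⊖-≤ᵛ []                                = refl
⊖-≤ᵛ {v = a ∷ _} {x ∷ _} (a≤x ∷ v≤ℓ) = cong₂ _∷_ (trans (ℤ.m-n≡m⊖n x a) (ℤ.⊖-≥ a≤x)) (⊖-≤ᵛ v≤ℓ)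

nonneg-toℤv : ∀ {N} (w : Vec ℕ N) → nonneg (toℤv w) ≡ true
nonneg-toℤv []      = refl
nonneg-toℤv (x ∷ w) = nonneg-toℤv w

∣toℤv∣ : ∀ {N} (w : Vec ℕ N) → Vec.map ∣_∣ (toℤv w) ≡ w
∣toℤv∣ []      = refl
∣toℤv∣ (x ∷ w) = cong (x ∷_) (∣toℤv∣ w)

nonneg-⊖-≰ : ∀ {N} (ℓ v : Vec ℕ N) → 𝟙≤ᵛ v ℓ ≡ 0 → nonneg (ℓ ⊖ v) ≡ false
nonneg-⊖-≰ []      []      ()
nonneg-⊖-≰ (x ∷ ℓ) (a ∷ v) 𝟙≡0 with a ≤? x
... | yes a≤x = trans (cong (λ z → nonneg (z ∷ (ℓ ⊖ v))) (trans (ℤ.m-n≡m⊖n x a) (ℤ.⊖-≥ a≤x)))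
                      (nonneg-⊖-≰ ℓ v (trans (sym (*-identityˡ _)) (subst (λ c → c * 𝟙≤ᵛ v ℓ ≡ 0) (𝟙≤-≤ a≤x) 𝟙≡0)))
... | no  a≰x = trans (cong (λ z → nonneg (z ∷ (ℓ ⊖ v))) (trans (ℤ.m-n≡m⊖n x a) (ℤ.⊖-< (≰⇒> a≰x))))
                      (nonneg-negative (a ∸ x) (m<n⇒0<n∸m (≰⇒> a≰x)))
  where nonneg-negative : ∀ d → 0 < d → nonneg ((ℤ.- + d) ∷ (ℓ ⊖ v)) ≡ false
        nonneg-negative (suc d) _ = refl

binomℤ-⊖ : ∀ {N} (F : Series N) k (ℓ v : Vec ℕ N) → binomℤ F k (ℓ ⊖ v) ≡ 𝟙≤ᵛ v ℓ * binom F k (ℓ ∸ᵛ v)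
binomℤ-⊖ F k ℓ v with ≤ᵛ⊎𝟙≤ᵛ≡0 v ℓ
... | inj₁ v≤ℓ rewrite ⊖-≤ᵛ v≤ℓ | nonneg-toℤv (ℓ ∸ᵛ v) | ∣toℤv∣ (ℓ ∸ᵛ v) | 𝟙≤ᵛ-≤ᵛ v≤ℓ = sym (+-identityʳ _)
... | inj₂ 𝟙≡0 rewrite nonneg-⊖-≰ ℓ v 𝟙≡0 | 𝟙≡0 = refl

removeAt-split : ∀ {N} (f : Series N) (m : Vec ℕ N) → f ≈ (f m ⊙ δ m) ⊞ removeAt f m
removeAt-split f m s with s ≟v m
... | yes refl rewrite 𝟙≡ᵛ-refl s = sym (trans (+-identityʳ _) (*-identityʳ (f s)))
... | no  s≢m  rewrite 𝟙≡ᵛ-≢ {v = m} {s} (λ m≡s → s≢m (sym m≡s)) | *-zeroʳ (f m) = refl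

split-off-value : ∀ {N} (f : Series N) k (ℓ m : Vec ℕ N) →
  binom f k ℓ ≡ sumℕ (map (λ i → f m ^ i * (k C i) * binomℤ (removeAt f m) (k ∸ i) (ℓ ⊖ (i ·v m))) (upTo (suc k)))
split-off-value f k ℓ m = begin
  binom f k ℓ                                                     ≡⟨ binom≈^ˢ f k ℓ ⟩
  (f ^ˢ k) ℓ                                                      ≡⟨ ^ˢ-cong k (removeAt-split f m) ℓ ⟩
  (((c ⊙ δ m) ⊞ g) ^ˢ k) ℓ                                        ≡⟨ binomial-theorem (c ⊙ δ m) g k ℓ ⟩
  ∑ (suc k) (λ i → (k C i) * ((c ⊙ δ m) ^ˢ i ⋆ g ^ˢ (k ∸ i)) ℓ) ≡⟨ ∑-cong (suc k) term ⟩
  ∑ (suc k) (λ i → c ^ i * (k C i) * binomℤ g (k ∸ i) (ℓ ⊖ (i ·v m)))           ≡⟨ ∑∈-upTo (suc k) _ ⟨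
  ∑∈ (upTo (suc k)) (λ i → c ^ i * (k C i) * binomℤ g (k ∸ i) (ℓ ⊖ (i ·v m))) ∎
  where
  c = f m
  g = removeAt f m
  term : ∀ i → (k C i) * ((c ⊙ δ m) ^ˢ i ⋆ g ^ˢ (k ∸ i)) ℓ ≡ c ^ i * (k C i) * binomℤ g (k ∸ i) (ℓ ⊖ (i ·v m))
  term i = begin
    (k C i) * ((c ⊙ δ m) ^ˢ i ⋆ g ^ˢ (k ∸ i)) ℓ
      ≡⟨ cong ((k C i) *_) (monomial^ˢ⋆-apply c m i (g ^ˢ (k ∸ i)) ℓ) ⟩
    (k C i) * (c ^ i * (𝟙≤ᵛ (i ·v m) ℓ * (g ^ˢ (k ∸ i)) (ℓ ∸ᵛ (i ·v m))))
      ≡⟨ cong (λ z → (k C i) * (c ^ i * (𝟙≤ᵛ (i ·v m) ℓ * z))) (binom≈^ˢ g (k ∸ i) (ℓ ∸ᵛ (i ·v m))) ⟨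
    (k C i) * (c ^ i * (𝟙≤ᵛ (i ·v m) ℓ * binom g (k ∸ i) (ℓ ∸ᵛ (i ·v m))))
      ≡⟨ cong (λ z → (k C i) * (c ^ i * z)) (binomℤ-⊖ g (k ∸ i) ℓ (i ·v m)) ⟨
    (k C i) * (c ^ i * binomℤ g (k ∸ i) (ℓ ⊖ (i ·v m)))
      ≡⟨ trans (*-CS.x∙yz≈y∙xz (k C i) (c ^ i) _) (sym (*-assoc (c ^ i) (k C i) _)) ⟩
    c ^ i * (k C i) * binomℤ g (k ∸ i) (ℓ ⊖ (i ·v m)) ∎

fromℚᵘ-homo-+ : ∀ p q → fromℚᵘ (p ℚᵘ.+ q) ≡ fromℚᵘ p +ℚ fromℚᵘ q
fromℚᵘ-homo-+ p q = ℚ.toℚᵘ-injective (ℚᵘ.≃-trans (ℚ.toℚᵘ-fromℚᵘ (p ℚᵘ.+ q)) (ℚᵘ.≃-sym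
  (ℚᵘ.≃-trans (ℚ.toℚᵘ-homo-+ (fromℚᵘ p) (fromℚᵘ q))
              (ℚᵘ.+-cong (ℚ.toℚᵘ-fromℚᵘ p) (ℚ.toℚᵘ-fromℚᵘ q)))))

fromℚᵘ-homo-* : ∀ p q → fromℚᵘ (p ℚᵘ.* q) ≡ fromℚᵘ p *ℚ fromℚᵘ q
fromℚᵘ-homo-* p q = ℚ.toℚᵘ-injective (ℚᵘ.≃-trans (ℚ.toℚᵘ-fromℚᵘ (p ℚᵘ.* q)) (ℚᵘ.≃-sym
  (ℚᵘ.≃-trans (ℚ.toℚᵘ-homo-* (fromℚᵘ p) (fromℚᵘ q))
              (ℚᵘ.*-cong (ℚ.toℚᵘ-fromℚᵘ p) (ℚ.toℚᵘ-fromℚᵘ q)))))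

-- Both + a / suc d and ℕ→ℚ a unfold to fromℚᵘ (mkℚᵘ (+ a) d) and fromℚᵘ (mkℚᵘ (+ a) 0).
ℕ→ℚ-+ : ∀ a b → ℕ→ℚ (a + b) ≡ ℕ→ℚ a +ℚ ℕ→ℚ b
ℕ→ℚ-+ a b = trans (ℚ.fromℚᵘ-cong {mkℚᵘ (+ (a + b)) 0} {mkℚᵘ (+ a) 0 ℚᵘ.+ mkℚᵘ (+ b) 0} (*≡* cross))
                  (fromℚᵘ-homo-+ (mkℚᵘ (+ a) 0) (mkℚᵘ (+ b) 0))
  where
  sum-cross : ∀ x y → (x ℤ.+ y) ℤ.* + 1 ≡ (x ℤ.* + 1 ℤ.+ y ℤ.* + 1) ℤ.* + 1
  sum-cross = ℤ-solve-∀
  cross : + (a + b) ℤ.* + 1 ≡ (+ a ℤ.* + 1 ℤ.+ + b ℤ.* + 1) ℤ.* + 1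
  cross = trans (cong (ℤ._* + 1) (ℤ.pos-+ a b)) (sum-cross (+ a) (+ b))

/-*-ℕ→ℚ : ∀ a d b c .{{_ : NonZero d}} → a * b ≡ c * d → (+ a / d) *ℚ ℕ→ℚ b ≡ ℕ→ℚ c
/-*-ℕ→ℚ a (suc d) b c ab≡cd =
  trans (sym (fromℚᵘ-homo-* (mkℚᵘ (+ a) d) (mkℚᵘ (+ b) 0)))
        (ℚ.fromℚᵘ-cong {mkℚᵘ (+ a) d ℚᵘ.* mkℚᵘ (+ b) 0} {mkℚᵘ (+ c) 0} (*≡* cross))
  where
  cross : (+ a ℤ.* + b) ℤ.* + 1 ≡ + c ℤ.* + (suc d * 1)
  cross = begin
    (+ a ℤ.* + b) ℤ.* + 1  ≡⟨ ℤ.*-identityʳ _ ⟩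
    + a ℤ.* + b            ≡⟨ ℤ.pos-* a b ⟨
    + (a * b)              ≡⟨ cong +_ (trans ab≡cd (cong (c *_) (sym (*-identityʳ (suc d))))) ⟩
    + (c * (suc d * 1))    ≡⟨ ℤ.pos-* c (suc d * 1) ⟩
    + c ℤ.* + (suc d * 1)  ∎

sumℚ-ℕ→ℚ : ∀ {A : Set} (xs : List A) (F : A → ℕ) → sumℚ (map (λ x → ℕ→ℚ (F x)) xs) ≡ ℕ→ℚ (∑∈ xs F)
sumℚ-ℕ→ℚ []       F = refl
sumℚ-ℕ→ℚ (x ∷ xs) F = trans (cong (ℕ→ℚ (F x) +ℚ_) (sumℚ-ℕ→ℚ xs F)) (sym (ℕ→ℚ-+ (F x) (∑∈ xs F)))

-- The Euler operator xⱼ ∂/∂xⱼ.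
θ : ∀ {N} → Fin N → Series N → Series N
θ j A v = lookup v j * A v

θ-⋆ : ∀ {N} (j : Fin N) (A B : Series N) → θ j (A ⋆ B) ≈ θ j A ⋆ B ⊞ A ⋆ θ j B
θ-⋆ j A B v = begin
  lookup v j * ∑≤ v (λ s → A s * B (v ∸ᵛ s))
    ≡⟨ ∑≤-*ˡ v (lookup v j) (λ s → A s * B (v ∸ᵛ s)) ⟨
  ∑≤ v (λ s → lookup v j * (A s * B (v ∸ᵛ s)))
    ≡⟨ ∑≤-cong≤ v (λ s s≤v → trans (cong (_* (A s * B (v ∸ᵛ s))) (lookup-∸ᵛ s≤v j))
                                   (leibniz (lookup s j) _ (A s) _)) ⟩
  ∑≤ v (λ s → θ j A s * B (v ∸ᵛ s) + A s * θ j B (v ∸ᵛ s))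
    ≡⟨ ∑≤-+ v (λ s → θ j A s * B (v ∸ᵛ s)) (λ s → A s * θ j B (v ∸ᵛ s)) ⟩
  (θ j A ⋆ B) v + (A ⋆ θ j B) v ∎
  where leibniz : ∀ a b x y → (a + b) * (x * y) ≡ (a * x) * y + x * (b * y)
        leibniz = solve-∀

θ-1ˢ : ∀ {N} (j : Fin N) → θ j 1ˢ ≈ 0ˢ
θ-1ˢ {N} j v with v ≟v 𝟎
... | yes refl = cong (_* 𝟙≡ᵛ {N} 𝟎 𝟎) (Vec.lookup-replicate j 0)
... | no  v≢𝟎  rewrite 𝟙≡ᵛ-≢ (λ 𝟎≡v → v≢𝟎 (sym 𝟎≡v)) = *-zeroʳ (lookup v j)

θ-^ˢ : ∀ {N} (j : Fin N) (A : Series N) k → θ j (A ^ˢ suc k) ≈ suc k ⊙ (θ j A ⋆ A ^ˢ k)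
θ-^ˢ j A zero    v = begin
  θ j (A ⋆ 1ˢ) v                   ≡⟨ θ-⋆ j A 1ˢ v ⟩
  (θ j A ⋆ 1ˢ) v + (A ⋆ θ j 1ˢ) v  ≡⟨ cong (_+_ ((θ j A ⋆ 1ˢ) v)) (⋆-congʳ A (θ-1ˢ j) v) ⟩
  (θ j A ⋆ 1ˢ) v + (A ⋆ 0ˢ) v      ≡⟨ cong (_+_ ((θ j A ⋆ 1ˢ) v)) (∑≤-0 v (λ s → *-zeroʳ (A s))) ⟩
  (θ j A ⋆ 1ˢ) v + 0               ∎
θ-^ˢ j A (suc k) v = begin
  θ j (A ⋆ A ^ˢ suc k) v                                   ≡⟨ θ-⋆ j A (A ^ˢ suc k) v ⟩
  (θ j A ⋆ A ^ˢ suc k) v + (A ⋆ θ j (A ^ˢ suc k)) v        ≡⟨ cong (_+_ ((θ j A ⋆ A ^ˢ suc k) v)) (⋆-congʳ A (θ-^ˢ j A k) v) ⟩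
  (θ j A ⋆ A ^ˢ suc k) v + (A ⋆ (suc k ⊙ (θ j A ⋆ A ^ˢ k))) v
    ≡⟨ cong (_+_ ((θ j A ⋆ A ^ˢ suc k) v)) (⋆-⊙ (suc k) A (θ j A ⋆ A ^ˢ k) v) ⟩
  (θ j A ⋆ A ^ˢ suc k) v + suc k * (A ⋆ (θ j A ⋆ A ^ˢ k)) v
    ≡⟨ cong (λ z → (θ j A ⋆ A ^ˢ suc k) v + suc k * z) (⋆-lcomm A (θ j A) (A ^ˢ k) v) ⟩
  (θ j A ⋆ A ^ˢ suc k) v + suc k * (θ j A ⋆ A ^ˢ suc k) v  ∎
  where ⋆-lcomm : ∀ (A B E : Series _) → A ⋆ (B ⋆ E) ≈ B ⋆ (A ⋆ E)
        ⋆-lcomm A B E = ≈-trans (≈-sym (⋆-assoc A B E)) (≈-trans (⋆-congˡ E (⋆-comm A B)) (⋆-assoc B A E))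

θ-binom : ∀ {N} (j : Fin N) (f : Series N) k ℓ → lookup ℓ j * binom f (suc k) ℓ ≡ suc k * (θ j f ⋆ f ^ˢ k) ℓ
θ-binom j f k ℓ = trans (cong (lookup ℓ j *_) (binom≈^ˢ f (suc k) ℓ)) (θ-^ˢ j f k ℓ)

∑∈-θ-binom : ∀ {N} (j : Fin N) (f : Series N) {i k} → i ≤ k → ∀ ℓ →
  ∑∈ (box ℓ) (λ s → lookup s j * binom f (suc i) s * binomℤ f (k ∸ i) (ℓ ⊖ s)) ≡ suc i * (θ j f ⋆ f ^ˢ k) ℓ
∑∈-θ-binom j f {i} {k} i≤k ℓ = begin
  ∑∈ (box ℓ) (λ s → lookup s j * binom f (suc i) s * binomℤ f (k ∸ i) (ℓ ⊖ s))
    ≡⟨ ∑∈-box ℓ _ ⟩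
  ∑≤ ℓ (λ s → lookup s j * binom f (suc i) s * binomℤ f (k ∸ i) (ℓ ⊖ s))
    ≡⟨ ∑≤-cong≤ ℓ (λ s s≤ℓ → cong₂ _*_ (cong (lookup s j *_) (binom≈^ˢ f (suc i) s)) (binomℤ-⊖-≤ᵛ s≤ℓ)) ⟩
  (θ j (f ^ˢ suc i) ⋆ f ^ˢ (k ∸ i)) ℓ
    ≡⟨ ⋆-congˡ (f ^ˢ (k ∸ i)) (θ-^ˢ j f i) ℓ ⟩
  ((suc i ⊙ (θ j f ⋆ f ^ˢ i)) ⋆ f ^ˢ (k ∸ i)) ℓ
    ≡⟨ ⊙-⋆ (suc i) (θ j f ⋆ f ^ˢ i) (f ^ˢ (k ∸ i)) ℓ ⟩
  suc i * (θ j f ⋆ f ^ˢ i ⋆ f ^ˢ (k ∸ i)) ℓ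
    ≡⟨ cong (suc i *_) (⋆-assoc (θ j f) (f ^ˢ i) (f ^ˢ (k ∸ i)) ℓ) ⟩
  suc i * (θ j f ⋆ (f ^ˢ i ⋆ f ^ˢ (k ∸ i))) ℓ
    ≡⟨ cong (suc i *_) (⋆-congʳ (θ j f) (^ˢ-+ f i (k ∸ i)) ℓ) ⟨
  suc i * (θ j f ⋆ f ^ˢ (i + (k ∸ i))) ℓ
    ≡⟨ cong (λ n → suc i * (θ j f ⋆ f ^ˢ n) ℓ) (m+[n∸m]≡n i≤k) ⟩
  suc i * (θ j f ⋆ f ^ˢ k) ℓ ∎
  where
  binomℤ-⊖-≤ᵛ : ∀ {s} → s ≤ᵛ ℓ → binomℤ f (k ∸ i) (ℓ ⊖ s) ≡ (f ^ˢ (k ∸ i)) (ℓ ∸ᵛ s)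
  binomℤ-⊖-≤ᵛ {s} s≤ℓ = begin
    binomℤ f (k ∸ i) (ℓ ⊖ s)               ≡⟨ binomℤ-⊖ f (k ∸ i) ℓ s ⟩
    𝟙≤ᵛ s ℓ * binom f (k ∸ i) (ℓ ∸ᵛ s)     ≡⟨ cong (_* binom f (k ∸ i) (ℓ ∸ᵛ s)) (𝟙≤ᵛ-≤ᵛ s≤ℓ) ⟩
    1 * binom f (k ∸ i) (ℓ ∸ᵛ s)           ≡⟨ *-identityˡ _ ⟩
    binom f (k ∸ i) (ℓ ∸ᵛ s)               ≡⟨ binom≈^ˢ f (k ∸ i) (ℓ ∸ᵛ s) ⟩
    (f ^ˢ (k ∸ i)) (ℓ ∸ᵛ s)                ∎

euler-identity : ∀ {N} (f : Series N) k (ℓ : Vec ℕ N) i (0<i : 0 < i) → i ≤ k → (j : Fin N) →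
  ℕ→ℚ (lookup ℓ j * binom f k ℓ)
    ≡ ((+ k / i) {{>-nonZero 0<i}}) *ℚ
        sumℚ (map (λ s → ℕ→ℚ (lookup s j * binom f i s * binomℤ f (k ∸ i) (ℓ ⊖ s))) (box ℓ))
euler-identity f (suc k) ℓ (suc i) _ (s≤s i≤k) j = begin
  ℕ→ℚ (lookup ℓ j * binom f (suc k) ℓ)         ≡⟨ cong ℕ→ℚ (θ-binom j f k ℓ) ⟩
  ℕ→ℚ (suc k * X)                               ≡⟨ /-*-ℕ→ℚ (suc k) (suc i) (suc i * X) (suc k * X) (rescale (suc k) (suc i) X) ⟨
  (+ suc k / suc i) *ℚ ℕ→ℚ (suc i * X)          ≡⟨ cong (λ n → (+ suc k / suc i) *ℚ ℕ→ℚ n) (∑∈-θ-binom j f i≤k ℓ) ⟨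
  (+ suc k / suc i) *ℚ ℕ→ℚ (∑∈ (box ℓ) G)       ≡⟨ cong ((+ suc k / suc i) *ℚ_) (sumℚ-ℕ→ℚ (box ℓ) G) ⟨
  (+ suc k / suc i) *ℚ sumℚ (map (λ s → ℕ→ℚ (G s)) (box ℓ)) ∎
  where
  X = (θ j f ⋆ f ^ˢ k) ℓ
  G : Vec ℕ _ → ℕ
  G s = lookup s j * binom f (suc i) s * binomℤ f (k ∸ i) (ℓ ⊖ s)
  rescale : ∀ m n x → m * (n * x) ≡ m * x * n
  rescale = solve-∀

-- Multinomial expansion

multinomialℕ : ∀ {n} → Vec ℕ n → ℕ
multinomialℕ []       = 1
multinomialℕ (r ∷ rs) = ((r + sumV rs) C r) * multinomialℕ rs

n!≡nCk*k!*[n∸k]! : ∀ {n k} → k ≤ n → n ! ≡ (n C k) * (k ! * (n ∸ k) !)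
n!≡nCk*k!*[n∸k]! {n} {k} k≤n =
  sym (trans (cong (_* (k ! * (n ∸ k) !)) (nCk≡n!/k![n-k]! k≤n)) (m/n*n≡m (k![n∸k]!∣n! k≤n)))
  where instance _ = m*n≢0 (k !) ((n ∸ k) !) {{k !≢0}} {{(n ∸ k) !≢0}}

sumV!≡multinomialℕ*prodFact : ∀ {n} (rs : Vec ℕ n) → sumV rs ! ≡ multinomialℕ rs * prodFact rs
sumV!≡multinomialℕ*prodFact []       = refl
sumV!≡multinomialℕ*prodFact (r ∷ rs) = begin
  (r + sumV rs) !                                      ≡⟨ n!≡nCk*k!*[n∸k]! (m≤m+n r (sumV rs)) ⟩
  ((r + sumV rs) C r) * (r ! * (r + sumV rs ∸ r) !)    ≡⟨ cong (λ n → ((r + sumV rs) C r) * (r ! * n !)) (m+n∸m≡n r (sumV rs)) ⟩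
  ((r + sumV rs) C r) * (r ! * sumV rs !)              ≡⟨ cong (λ n → ((r + sumV rs) C r) * (r ! * n)) (sumV!≡multinomialℕ*prodFact rs) ⟩
  ((r + sumV rs) C r) * (r ! * (multinomialℕ rs * prodFact rs))
    ≡⟨ regroup ((r + sumV rs) C r) (r !) (multinomialℕ rs) (prodFact rs) ⟩
  multinomialℕ (r ∷ rs) * prodFact (r ∷ rs)            ∎
  where regroup : ∀ c a m p → c * (a * (m * p)) ≡ (c * m) * (a * p)
        regroup = solve-∀

restrict : ∀ {N n} → Series N → Vec (Vec ℕ N) n → Series N
restrict f []       = 0ˢ
restrict f (s ∷ ss) = (f s ⊙ δ s) ⊞ restrict f ss

infix 4 _≈[_]_
_≈[_]_ : ∀ {N} → Series N → Vec ℕ N → Series N → Set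
A ≈[ ℓ ] B = ∀ v → v ≤ᵛ ℓ → A v ≡ B v

⋆-cong-≈[] : ∀ {N} {ℓ : Vec ℕ N} {A A′ B B′ : Series N} → A ≈[ ℓ ] A′ → B ≈[ ℓ ] B′ → A ⋆ B ≈[ ℓ ] A′ ⋆ B′
⋆-cong-≈[] A≈A′ B≈B′ v v≤ℓ =
  ∑≤-cong≤ v (λ s s≤v → cong₂ _*_ (A≈A′ s (≤ᵛ-trans s≤v v≤ℓ)) (B≈B′ (v ∸ᵛ s) (≤ᵛ-trans (∸ᵛ-≤ᵛ v s) v≤ℓ)))

^ˢ-cong-≈[] : ∀ {N} {ℓ : Vec ℕ N} {A B : Series N} k → A ≈[ ℓ ] B → A ^ˢ k ≈[ ℓ ] B ^ˢ k
^ˢ-cong-≈[] zero    A≈B v _ = refl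
^ˢ-cong-≈[] (suc k) A≈B     = ⋆-cong-≈[] A≈B (^ˢ-cong-≈[] k A≈B)

restrict-fromList : ∀ {N} (f : Series N) (xs : List (Vec ℕ N)) v → restrict f (Vec.fromList xs) v ≡ ∑∈ xs (λ s → f s * 𝟙≡ᵛ s v)
restrict-fromList f []       v = refl
restrict-fromList f (x ∷ xs) v = cong (_+_ (f x * 𝟙≡ᵛ x v)) (restrict-fromList f xs v)

≈[]-restrict : ∀ {N} (f : Series N) (ℓ : Vec ℕ N) → f ≈[ ℓ ] restrict f (sVec ℓ)
≈[]-restrict f ℓ v v≤ℓ = sym (begin
  restrict f (Vec.fromList (box ℓ)) v ≡⟨ restrict-fromList f (box ℓ) v ⟩
  ∑∈ (box ℓ) (λ s → f s * 𝟙≡ᵛ s v)    ≡⟨ ∑∈-box ℓ _ ⟩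
  ∑≤ ℓ (λ s → f s * 𝟙≡ᵛ s v)          ≡⟨ ∑≤-cong ℓ (λ s → trans (*-comm (f s) _) (cong (_* f s) (𝟙≡ᵛ-sym s v))) ⟩
  ∑≤ ℓ (λ s → 𝟙≡ᵛ v s * f s)          ≡⟨ ∑≤-𝟙≡ᵛ ℓ v f ⟩
  𝟙≤ᵛ v ℓ * f v                       ≡⟨ cong (_* f v) (𝟙≤ᵛ-≤ᵛ v≤ℓ) ⟩
  1 * f v                             ≡⟨ *-identityˡ (f v) ⟩
  f v                                 ∎)

multinomialTerm : ∀ {N n} → Series N → Vec (Vec ℕ N) n → ℕ → Vec ℕ N → Vec ℕ n → ℕ
multinomialTerm f ss k w rs = 𝟙≡ (sumV rs) k * (multinomialℕ rs * prodPow f rs ss * 𝟙≡ᵛ (lincomb rs ss) w)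

multinomialTerm-∷ : ∀ {N n} (f : Series N) s (ss : Vec (Vec ℕ N) n) k w i rs →
  multinomialTerm f (s ∷ ss) k w (i ∷ rs)
    ≡ 𝟙≤ i k * ((k C i) * (f s ^ i * (𝟙≤ᵛ (i ·v s) w * multinomialTerm f ss (k ∸ i) (w ∸ᵛ (i ·v s)) rs)))
multinomialTerm-∷ f s ss k w i rs = begin
  𝟙≡ (i + σ) k * (((i + σ) C i) * μ * (f s ^ i * P) * 𝟙≡ᵛ ((i ·v s) ⊕ L) w)
    ≡⟨ 𝟙≡-*-subst (i + σ) k (λ n → (n C i) * μ * (f s ^ i * P) * 𝟙≡ᵛ ((i ·v s) ⊕ L) w) ⟩
  𝟙≡ (i + σ) k * ((k C i) * μ * (f s ^ i * P) * 𝟙≡ᵛ ((i ·v s) ⊕ L) w)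
    ≡⟨ cong₂ (λ a b → a * ((k C i) * μ * (f s ^ i * P) * b)) (𝟙≡-+ i σ k) (𝟙≡ᵛ-⊕ (i ·v s) L w) ⟩
  (𝟙≤ i k * 𝟙≡ σ (k ∸ i)) * ((k C i) * μ * (f s ^ i * P) * (𝟙≤ᵛ (i ·v s) w * 𝟙≡ᵛ L (w ∸ᵛ (i ·v s))))
    ≡⟨ regroup (𝟙≤ i k) (𝟙≡ σ (k ∸ i)) (k C i) μ (f s ^ i) P (𝟙≤ᵛ (i ·v s) w) (𝟙≡ᵛ L (w ∸ᵛ (i ·v s))) ⟩
  𝟙≤ i k * ((k C i) * (f s ^ i * (𝟙≤ᵛ (i ·v s) w * multinomialTerm f ss (k ∸ i) (w ∸ᵛ (i ·v s)) rs))) ∎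
  where
  σ = sumV rs
  μ = multinomialℕ rs
  P = prodPow f rs ss
  L = lincomb rs ss
  regroup : ∀ a e c m x p b q → (a * e) * (c * m * (x * p) * (b * q)) ≡ a * (c * (x * (b * (e * (m * p * q)))))
  regroup = solve-∀

multinomialTerm-on-partition : ∀ {N n} (f : Series N) (ss : Vec (Vec ℕ N) n) rs →
  multinomialTerm f ss (sumV rs) (lincomb rs ss) rs ≡ multinomialℕ rs * prodPow f rs ss
multinomialTerm-on-partition f ss rs rewrite 𝟙≡-refl (sumV rs) | 𝟙≡ᵛ-refl (lincomb rs ss) =
  trans (*-identityˡ _) (*-identityʳ _)

-- Exponent vectors range over {0,…,K}ⁿ for a bound K ≥ k fixed in advance, as the exponent drops to k ∸ i
-- in the recursion.
restrict-^ˢ : ∀ {N n} (f : Series N) (ss : Vec (Vec ℕ N) n) K k → k ≤ K → ∀ w →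
  (restrict f ss ^ˢ k) w ≡ ∑≤ (replicate n K) (multinomialTerm f ss k w)
restrict-^ˢ f []       K zero    _ w = sym (trans (*-identityˡ _) (*-identityˡ _))
restrict-^ˢ f []       K (suc k) _ w = ⋆-zeroˡ (restrict f [] ^ˢ k) w
restrict-^ˢ {n = suc n} f (s ∷ ss) K k k≤K w = begin
  (((c ⊙ δ s) ⊞ P) ^ˢ k) w
    ≡⟨ binomial-theorem (c ⊙ δ s) P k w ⟩
  ∑ (suc k) (λ i → (k C i) * ((c ⊙ δ s) ^ˢ i ⋆ P ^ˢ (k ∸ i)) w)
    ≡⟨ ∑-cong< (suc k) (λ i i<1+k → expand i (s≤s⁻¹ i<1+k)) ⟩
  ∑ (suc k) (λ i → ∑≤ R (T i))
    ≡⟨ ∑-truncate k (suc K) (λ i → ∑≤ R (T i)) (s≤s k≤K) ⟨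
  ∑ (suc K) (λ i → 𝟙≤ i k * ∑≤ R (T i))
    ≡⟨ ∑-cong (suc K) (λ i → trans (sym (∑≤-*ˡ R (𝟙≤ i k) (T i)))
                                   (∑≤-cong R (λ rs → sym (multinomialTerm-∷ f s ss k w i rs)))) ⟩
  ∑ (suc K) (λ i → ∑≤ R (λ rs → multinomialTerm f (s ∷ ss) k w (i ∷ rs))) ∎
  where
  c = f s
  P = restrict f ss
  R = replicate n K
  T : ℕ → Vec ℕ n → ℕ
  T i rs = (k C i) * (c ^ i * (𝟙≤ᵛ (i ·v s) w * multinomialTerm f ss (k ∸ i) (w ∸ᵛ (i ·v s)) rs))
  expand : ∀ i → i ≤ k → (k C i) * ((c ⊙ δ s) ^ˢ i ⋆ P ^ˢ (k ∸ i)) w ≡ ∑≤ R (T i)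
  expand i i≤k = begin
    (k C i) * ((c ⊙ δ s) ^ˢ i ⋆ P ^ˢ (k ∸ i)) w
      ≡⟨ cong ((k C i) *_) (monomial^ˢ⋆-apply c s i (P ^ˢ (k ∸ i)) w) ⟩
    (k C i) * (c ^ i * (𝟙≤ᵛ (i ·v s) w * (P ^ˢ (k ∸ i)) (w ∸ᵛ (i ·v s))))
      ≡⟨ cong (λ z → (k C i) * (c ^ i * (𝟙≤ᵛ (i ·v s) w * z)))
              (restrict-^ˢ f ss K (k ∸ i) (≤-trans (m∸n≤m k i) k≤K) (w ∸ᵛ (i ·v s))) ⟩
    (k C i) * (c ^ i * (𝟙≤ᵛ (i ·v s) w * ∑≤ R Q))
      ≡⟨ cong (λ z → (k C i) * (c ^ i * z)) (∑≤-*ˡ R (𝟙≤ᵛ (i ·v s) w) Q) ⟨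
    (k C i) * (c ^ i * ∑≤ R (λ rs → 𝟙≤ᵛ (i ·v s) w * Q rs))
      ≡⟨ cong ((k C i) *_) (∑≤-*ˡ R (c ^ i) _) ⟨
    (k C i) * ∑≤ R (λ rs → c ^ i * (𝟙≤ᵛ (i ·v s) w * Q rs))
      ≡⟨ ∑≤-*ˡ R (k C i) _ ⟨
    ∑≤ R (T i) ∎
    where Q = multinomialTerm f ss (k ∸ i) (w ∸ᵛ (i ·v s))

isPartition-sound : ∀ {N} (ℓ : Vec ℕ N) k rs → isPartition ℓ k rs ≡ true → sumV rs ≡ k × lincomb rs (sVec ℓ) ≡ ℓ
isPartition-sound ℓ k rs with sumV rs ≟ k | lincomb rs (sVec ℓ) ≟v ℓ
... | yes σ≡k | yes lc≡ℓ = λ _ → σ≡k , lc≡ℓ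
... | no  _   | _        = λ ()
... | yes _   | no  _    = λ ()

isPartition-complete : ∀ {N} (ℓ : Vec ℕ N) k rs → ¬ isPartition ℓ k rs ≡ true →
  𝟙≡ (sumV rs) k ≡ 0 ⊎ 𝟙≡ᵛ (lincomb rs (sVec ℓ)) ℓ ≡ 0
isPartition-complete ℓ k rs with sumV rs ≟ k | lincomb rs (sVec ℓ) ≟v ℓ
... | yes _   | yes _    = λ ¬true → ⊥-elim (¬true refl)
... | no  σ≢k | _        = λ _ → inj₁ (𝟙≡-≢ σ≢k)
... | yes _   | no  lc≢ℓ = λ _ → inj₂ (𝟙≡ᵛ-≢ lc≢ℓ)

sumℚ-filter : ∀ {A : Set} {P : A → Set} (P? : ∀ x → Dec (P x)) (xs : List A) (G : A → ℚ) (H : A → ℕ) →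
  (∀ x → P x → G x ≡ ℕ→ℚ (H x)) → (∀ x → ¬ P x → H x ≡ 0) → sumℚ (map G (filter P? xs)) ≡ ℕ→ℚ (∑∈ xs H)
sumℚ-filter P? []       G H G≡H H≡0 = refl
sumℚ-filter P? (x ∷ xs) G H G≡H H≡0 with P? x
... | yes p  = trans (cong₂ _+ℚ_ (G≡H x p) (sumℚ-filter P? xs G H G≡H H≡0)) (sym (ℕ→ℚ-+ (H x) (∑∈ xs H)))
... | no  ¬p = trans (sumℚ-filter P? xs G H G≡H H≡0) (cong (λ n → ℕ→ℚ (n + ∑∈ xs H)) (sym (H≡0 x ¬p)))

multinomial-theorem : ∀ {N} (f : Series N) k (ℓ : Vec ℕ N) →
  ℕ→ℚ (binom f k ℓ) ≡ sumℚ (map (λ rs → multinomial k rs *ℚ ℕ→ℚ (prodPow f rs (sVec ℓ))) (partitions ℓ k))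
multinomial-theorem f k ℓ = sym (begin
  sumℚ (map G (partitions ℓ k))
    ≡⟨ sumℚ-filter (λ rs → isPartition ℓ k rs Data.Bool.≟ true) (tuples (M ℓ) (upTo (suc k))) G H on-partitions off-partitions ⟩
  ℕ→ℚ (∑∈ (tuples (M ℓ) (upTo (suc k))) H)    ≡⟨ cong ℕ→ℚ (∑∈-tuples-upTo (M ℓ) k H) ⟩
  ℕ→ℚ (∑≤ (replicate (M ℓ) k) H)              ≡⟨ cong ℕ→ℚ (restrict-^ˢ f ss k k ≤-refl ℓ) ⟨
  ℕ→ℚ ((restrict f ss ^ˢ k) ℓ)                ≡⟨ cong ℕ→ℚ (^ˢ-cong-≈[] k (≈[]-restrict f ℓ) ℓ ≤ᵛ-refl) ⟨
  ℕ→ℚ ((f ^ˢ k) ℓ)                            ≡⟨ cong ℕ→ℚ (binom≈^ˢ f k ℓ) ⟨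
  ℕ→ℚ (binom f k ℓ)                           ∎)
  where
  ss = sVec ℓ
  G : Vec ℕ (M ℓ) → ℚ
  G rs = multinomial k rs *ℚ ℕ→ℚ (prodPow f rs ss)
  H : Vec ℕ (M ℓ) → ℕ
  H = multinomialTerm f ss k ℓ
  on-partitions : ∀ rs → isPartition ℓ k rs ≡ true → G rs ≡ ℕ→ℚ (H rs)
  on-partitions rs p with isPartition-sound ℓ k rs p
  ... | refl , lc≡ℓ = begin
    multinomial (sumV rs) rs *ℚ ℕ→ℚ (prodPow f rs ss)
      ≡⟨ /-*-ℕ→ℚ (sumV rs !) (prodFact rs) (prodPow f rs ss) (multinomialℕ rs * prodPow f rs ss) {{prodFact≢0 rs}}
                 (trans (cong (_* prodPow f rs ss) (sumV!≡multinomialℕ*prodFact rs))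
                        (*-CS.xy∙z≈xz∙y (multinomialℕ rs) (prodFact rs) _)) ⟩
    ℕ→ℚ (multinomialℕ rs * prodPow f rs ss)
      ≡⟨ cong ℕ→ℚ (multinomialTerm-on-partition f ss rs) ⟨
    ℕ→ℚ (multinomialTerm f ss (sumV rs) (lincomb rs ss) rs)
      ≡⟨ cong (λ w → ℕ→ℚ (multinomialTerm f ss (sumV rs) w rs)) lc≡ℓ ⟩
    ℕ→ℚ (H rs) ∎
  off-partitions : ∀ rs → ¬ isPartition ℓ k rs ≡ true → H rs ≡ 0
  off-partitions rs ¬p with isPartition-complete ℓ k rs ¬p
  ... | inj₁ 𝟙≡0 rewrite 𝟙≡0 = refl
  ... | inj₂ 𝟙≡0 rewrite 𝟙≡0 =
    trans (cong (𝟙≡ (sumV rs) k *_) (*-zeroʳ (multinomialℕ rs * prodPow f rs ss))) (*-zeroʳ (𝟙≡ (sumV rs) k))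

theorem2 : (N : ℕ) → 1 ≤ N → (f : Vec ℕ N → ℕ) → (k : ℕ) → (ℓ : Vec ℕ N) →
    (ℕ→ℚ (binom f k ℓ)
      ≡ sumℚ (map (λ rs → multinomial k rs *ℚ ℕ→ℚ (prodPow f rs (sVec ℓ))) (partitions ℓ k)))
    × ((r : ℕ) → 1 ≤ r → (ks : Vec ℕ r) → sumV ks ≡ k →
        binom f k ℓ ≡ sumℕ (map (prodBinom f ks) (tuplesSumming r ℓ)))
    × ((i : ℕ) → (0<i : 0 < i) → i ≤ k → (j : Fin N) →
        ℕ→ℚ (lookup ℓ j * binom f k ℓ)
          ≡ ((+ k / i) {{>-nonZero 0<i}}) *ℚ
              sumℚ (map (λ s → ℕ→ℚ (lookup s j * binom f i s * binomℤ f (k ∸ i) (ℓ ⊖ s))) (box ℓ)))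
    × ((m : Vec ℕ N) →
        binom f k ℓ
          ≡ sumℕ (map (λ i → f m ^ i * (k C i) * binomℤ (removeAt f m) (k ∸ i) (ℓ ⊖ (i ·v m)))
                      (upTo (suc k))))
theorem2 N _ f k ℓ =
  multinomial-theorem f k ℓ ,
  (λ r _ ks σ≡k → trans (cong (λ n → binom f n ℓ) (sym σ≡k)) (vandermonde f ks ℓ)) ,
  euler-identity f k ℓ ,
  split-off-value f k ℓ
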